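{- Let $q$ be a prime power, $k$ a positive divisor of $q-1$, $e=\frac{q-1}{k}$, $\alpha$ a primitive element of $F=GF(q)$, $C_a=\langle\alpha^e\rangle\alpha^a$ for integers $a$, and $(a,b)=|C_b\cap(C_a+1)|$ for $0\le a,b<e$. For such $a,b$ define the $k\times k$ matrix $C^{(a,b)}$ over $F$ by $(C^{(a,b)})_{i,j}=1+\alpha^{ak}-\alpha^{bk}$ if $i=j$, $(C^{(a,b)})_{i,j}=\binom{k}{j-i}$ if $i<j$, and $(C^{(a,b)})_{i,j}=\alpha^{ak}\binom{k}{i-j}$ if $i>j$ (binomial coefficients taken in $F$). Then \[(a,b)=k-\operatorname{rank}C^{(a,b)}=\deg\bigl(\gcd((X+1)^k-\alpha^{bk},\,X^k-\alpha^{ak})\bigr),\] the gcd being taken in $F[X]$. -}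

module Defs where

open import Level using (_⊔_)
open import Algebra.Bundles using (CommutativeRing)
open import Data.Nat as ℕ using (ℕ; zero; suc; _<ᵇ_; _∸_)
open import Data.Nat.Combinatorics using (_C_)
open import Data.Nat.Primality using (Prime)
open import Data.Fin using (Fin; toℕ)
open import Data.List using (List; []; _∷_)
open import Data.Bool using (if_then_else_)
open import Data.Product using (Σ; ∃; _×_)
open import Relation.Nullary using (¬_)
open import Relation.Binary.PropositionalEquality using (_≡_)

IsPrimePower : ℕ → Set
IsPrimePower q = Σ ℕ λ p → Σ ℕ λ m → Prime p × q ≡ p ℕ.^ suc m

module _ {c ℓ} (R : CommutativeRing c ℓ) where
  open CommutativeRing R renaming (Carrier to F)

  IsField : Set (c ⊔ ℓ)
  IsField = ¬ (1# ≈ 0#) × (∀ x → ¬ (x ≈ 0#) → ∃ λ y → x * y ≈ 1#)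

  fromℕ : ℕ → F
  fromℕ zero = 0#
  fromℕ (suc n) = 1# + fromℕ n

  pow : F → ℕ → F
  pow x zero = 1#
  pow x (suc n) = x * pow x n

  HasCard : ℕ → Set (c ⊔ ℓ)
  HasCard q = Σ (Fin q → F) λ enum →
      (∀ i j → enum i ≈ enum j → i ≡ j) × (∀ x → ∃ λ i → enum i ≈ x)

  IsPrimitive : F → Set (c ⊔ ℓ)
  IsPrimitive α = ¬ (α ≈ 0#) × (∀ x → ¬ (x ≈ 0#) → ∃ λ n → pow α n ≈ x)

  CardOf : (F → Set ℓ) → ℕ → Set (c ⊔ ℓ)
  CardOf P N = Σ (Fin N → F) λ f →
      (∀ i j → f i ≈ f j → i ≡ j) × (∀ i → P (f i)) × (∀ x → P x → ∃ λ i → f i ≈ x)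

  InClass : F → ℕ → ℕ → F → Set ℓ
  InClass α e a x = ∃ λ t → x ≈ pow α (e ℕ.* t ℕ.+ a)

  CycSet : F → ℕ → ℕ → ℕ → F → Set ℓ
  CycSet α e a b x = InClass α e b x × InClass α e a (x - 1#)

  CyclotomicNumber : F → ℕ → ℕ → ℕ → ℕ → Set (c ⊔ ℓ)
  CyclotomicNumber α e a b N = CardOf (CycSet α e a b) N

  ∑ : ∀ {n} → (Fin n → F) → F
  ∑ {zero} f = 0#
  ∑ {suc n} f = f Fin.zero + ∑ (λ i → f (Fin.suc i))

  Cmat : F → (k a b : ℕ) → Fin k → Fin k → F
  Cmat α k a b i j =
    if toℕ i <ᵇ toℕ j then fromℕ (k C (toℕ j ∸ toℕ i))
    else if toℕ j <ᵇ toℕ i then pow α (a ℕ.* k) * fromℕ (k C (toℕ i ∸ toℕ j))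
    else (1# + pow α (a ℕ.* k)) - pow α (b ℕ.* k)

  LinIndep : ∀ {m r} → (Fin r → Fin m → F) → Set (c ⊔ ℓ)
  LinIndep {m} {r} v = ∀ (cf : Fin r → F) →
      (∀ i → ∑ (λ j → cf j * v j i) ≈ 0#) → ∀ j → cf j ≈ 0#

  Rank : ∀ {m n} → (Fin m → Fin n → F) → ℕ → Set (c ⊔ ℓ)
  Rank {m} {n} M r =
      (Σ (Fin r → Fin n) λ σ → LinIndep (λ j i → M i (σ j)))
    × (∀ (σ : Fin (suc r) → Fin n) → ¬ LinIndep (λ j i → M i (σ j)))

  -- polynomials in F[X]: coefficient lists, constant term first
  Poly : Set c
  Poly = List F

  coeff : Poly → ℕ → F
  coeff [] n = 0#
  coeff (x ∷ p) zero = x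
  coeff (x ∷ p) (suc n) = coeff p n

  _≋_ : Poly → Poly → Set ℓ
  p ≋ p' = ∀ n → coeff p n ≈ coeff p' n

  _+ₚ_ : Poly → Poly → Poly
  [] +ₚ p' = p'
  (x ∷ p) +ₚ [] = x ∷ p
  (x ∷ p) +ₚ (y ∷ p') = (x + y) ∷ (p +ₚ p')

  scale : F → Poly → Poly
  scale a [] = []
  scale a (x ∷ p) = (a * x) ∷ scale a p

  _*ₚ_ : Poly → Poly → Poly
  [] *ₚ p' = []
  (x ∷ p) *ₚ p' = scale x p' +ₚ (0# ∷ (p *ₚ p'))

  powₚ : Poly → ℕ → Poly
  powₚ p zero = 1# ∷ []
  powₚ p (suc n) = p *ₚ powₚ p n

  constₚ : F → Poly
  constₚ a = a ∷ []

  Xₚ : Poly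
  Xₚ = 0# ∷ 1# ∷ []

  _∣ₚ_ : Poly → Poly → Set (c ⊔ ℓ)
  h ∣ₚ f = ∃ λ p → (h *ₚ p) ≋ f

  IsGCD : Poly → Poly → Poly → Set (c ⊔ ℓ)
  IsGCD d f g = d ∣ₚ f × d ∣ₚ g × (∀ h → h ∣ₚ f → h ∣ₚ g → h ∣ₚ d)

  Degree : Poly → ℕ → Set ℓ
  Degree p n = ¬ (coeff p n ≈ 0#) × (∀ m → n ℕ.< m → coeff p m ≈ 0#)

  polyF : F → ℕ → ℕ → Poly
  polyF α k b = powₚ (Xₚ +ₚ constₚ 1#) k +ₚ constₚ (- pow α (b ℕ.* k))

  polyG : F → ℕ → ℕ → Poly
  polyG α k a = powₚ Xₚ k +ₚ constₚ (- pow α (a ℕ.* k))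

module Submission where

-- Let β t = α^(e t + a) for t < k: these are the elements of C_a, and they are the k distinct
-- roots of g = X^k − α^(ak). Since x ∈ C_b exactly when x^k = α^(bk), the shift x ↦ x − 1 maps
-- C_b ∩ (C_a + 1) bijectively onto the set A of those β t that are roots of f = (X + 1)^k − α^(bk),
-- so (a,b) = |A|.
--
-- gcd(f, g) is divisible by X − β t for every t ∈ A, and g = gcd(f, g) · h where h vanishes at the
-- remaining β t; comparing degrees gives deg gcd(f, g) = |A|.
--
-- By the binomial theorem the vectors v t = (β t ^ j)ⱼ satisfy C v t = f(β t) v t, and they form a
-- basis because the β t are distinct (Vandermonde). So C is diagonalisable with eigenvalues f(β t),
-- and its rank is the number of t with f(β t) ≠ 0, which is k − |A|.

open import Level using (Level; _⊔_)
open import Algebra.Bundles using (CommutativeRing)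
open import Data.Nat as ℕ using (ℕ; zero; suc; _∸_; _%_; _/_; NonZero)
open import Data.Nat.DivMod using (m≡m%n+[m/n]*n; m%n<n; m<n⇒m%n≡m; m%n*o≡m*o%[n*o])
open import Data.Nat.Tactic.RingSolver using (solve-∀)
import Data.Nat.Properties as ℕₚ
open import Data.Nat.Combinatorics using (_C_; nCk≡nC[n∸k]; nCn≡1)
open import Data.Fin as Fin using (Fin; toℕ; punchIn; punchOut)
import Data.Fin.Properties as Finₚ
open import Data.Bool using (if_then_else_)
open import Data.List using ([]; _∷_)
open import Data.Product using (Σ; ∃; _×_; _,_; proj₁; proj₂)
open import Data.Sum using (_⊎_; inj₁; inj₂)
open import Data.Empty using (⊥-elim)
open import Function using (_∘_; id)
open import Function.Definitions using (Injective)
open import Data.Vec.Functional as Vec using ()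
import Data.Vec.Functional.Properties as Vecₚ
open import Relation.Nullary using (Dec; yes; no; ¬_)
open import Relation.Nullary.Decidable using (¬?; _×-dec_; decidable-stable)
open import Relation.Unary using (Decidable)
open import Relation.Binary.Definitions using (tri<; tri≈; tri>)
open import Relation.Binary.PropositionalEquality as ≡ using (_≡_; _≢_)
open import Defs hiding (coeff; _≋_; _+ₚ_; scale; _*ₚ_; powₚ; constₚ; Xₚ; _∣ₚ_)
import Defs as D


module RingProperties {c ℓ} (R : CommutativeRing c ℓ) where

  open CommutativeRing R renaming (Carrier to F) hiding (zero)
  open import Relation.Binary.Reasoning.Setoid setoid
  import Algebra.Properties.Semiring.Sum semiring as Sum
  open Sum using (sum)
  open import Algebra.Properties.Semiring.Exp semiring using (_^_; ^-homo-*; ^-assocʳ)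
  open import Algebra.Properties.Ring ring using (-1*x≈-x)
  import Algebra.Properties.Semiring.Mult semiring as Mult
  import Algebra.Properties.CommutativeSemiring.Binomial commutativeSemiring as Binomial

  ∑≡sum : ∀ {n} (f : Fin n → F) → ∑ R f ≡ sum f
  ∑≡sum {zero} f = ≡.refl
  ∑≡sum {suc n} f = ≡.cong (f Fin.zero +_) (∑≡sum (f ∘ Fin.suc))

  pow≡^ : ∀ x n → pow R x n ≡ x ^ n
  pow≡^ x zero = ≡.refl
  pow≡^ x (suc n) = ≡.cong (x *_) (pow≡^ x n)

  fromℕ≡×1# : ∀ n → fromℕ R n ≡ n Mult.× 1#
  fromℕ≡×1# zero = ≡.refl
  fromℕ≡×1# (suc n) = ≡.cong (1# +_) (fromℕ≡×1# n)

  ∑-cong : ∀ {n} {f g : Fin n → F} → (∀ i → f i ≈ g i) → ∑ R f ≈ ∑ R g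
  ∑-cong {f = f} {g} f≈g = begin
    ∑ R f ≡⟨ ∑≡sum f ⟩
    sum f ≈⟨ Sum.sum-cong-≋ f≈g ⟩
    sum g ≡⟨ ∑≡sum g ⟨
    ∑ R g ∎

  ∑-distrib-+ : ∀ {n} (f g : Fin n → F) → ∑ R (λ i → f i + g i) ≈ ∑ R f + ∑ R g
  ∑-distrib-+ f g = begin
    ∑ R (λ i → f i + g i) ≡⟨ ∑≡sum (λ i → f i + g i) ⟩
    sum (λ i → f i + g i) ≈⟨ Sum.∑-distrib-+ f g ⟩
    sum f + sum g ≡⟨ ≡.cong₂ _+_ (∑≡sum f) (∑≡sum g) ⟨
    ∑ R f + ∑ R g ∎

  ∑-zero : ∀ n → ∑ R {n} (λ _ → 0#) ≈ 0#
  ∑-zero n = trans (reflexive (∑≡sum {n} (λ _ → 0#))) (Sum.sum-replicate-zero n)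

  *-distribˡ-∑ : ∀ {n} x (f : Fin n → F) → x * ∑ R f ≈ ∑ R (λ i → x * f i)
  *-distribˡ-∑ x f = begin
    x * ∑ R f ≡⟨ ≡.cong (x *_) (∑≡sum f) ⟩
    x * sum f ≈⟨ Sum.*-distribˡ-sum x f ⟩
    sum (λ i → x * f i) ≡⟨ ∑≡sum (λ i → x * f i) ⟨
    ∑ R (λ i → x * f i) ∎

  *-distribʳ-∑ : ∀ {n} x (f : Fin n → F) → ∑ R f * x ≈ ∑ R (λ i → f i * x)
  *-distribʳ-∑ x f = begin
    ∑ R f * x ≡⟨ ≡.cong (_* x) (∑≡sum f) ⟩
    sum f * x ≈⟨ Sum.*-distribʳ-sum x f ⟩
    sum (λ i → f i * x) ≡⟨ ∑≡sum (λ i → f i * x) ⟨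
    ∑ R (λ i → f i * x) ∎

  ∑-comm : ∀ {m n} (f : Fin m → Fin n → F) →
           ∑ R (λ i → ∑ R (f i)) ≈ ∑ R (λ j → ∑ R (λ i → f i j))
  ∑-comm f = begin
    ∑ R (λ i → ∑ R (f i)) ≈⟨ ∑-cong (λ i → reflexive (∑≡sum (f i))) ⟩
    ∑ R (λ i → sum (f i)) ≡⟨ ∑≡sum (λ i → sum (f i)) ⟩
    sum (λ i → sum (f i)) ≈⟨ Sum.∑-comm f ⟩
    sum (λ j → sum (λ i → f i j)) ≡⟨ ∑≡sum (λ j → sum (λ i → f i j)) ⟨
    ∑ R (λ j → sum (λ i → f i j)) ≈⟨ ∑-cong (λ j → reflexive (∑≡sum (λ i → f i j))) ⟨
    ∑ R (λ j → ∑ R (λ i → f i j)) ∎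

  ∑-remove : ∀ {n} (i : Fin (suc n)) (f : Fin (suc n) → F) → ∑ R f ≈ f i + ∑ R (f ∘ punchIn i)
  ∑-remove i f = begin
    ∑ R f ≡⟨ ∑≡sum f ⟩
    sum f ≈⟨ Sum.sum-remove f ⟩
    f i + sum (f ∘ punchIn i) ≡⟨ ≡.cong (f i +_) (∑≡sum (f ∘ punchIn i)) ⟨
    f i + ∑ R (f ∘ punchIn i) ∎

  ∑-single : ∀ {n} (i : Fin n) (f : Fin n → F) → (∀ j → j ≢ i → f j ≈ 0#) → ∑ R f ≈ f i
  ∑-single {suc n} i f f≈0 = begin
    ∑ R f ≈⟨ ∑-remove i f ⟩
    f i + ∑ R (f ∘ punchIn i) ≈⟨ +-congˡ (∑-cong (λ l → f≈0 (punchIn i l) (Finₚ.punchInᵢ≢i i l))) ⟩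
    f i + ∑ R {n} (λ _ → 0#) ≈⟨ +-congˡ (∑-zero n) ⟩
    f i + 0# ≈⟨ +-identityʳ _ ⟩
    f i ∎

  ∑-neg : ∀ {n} (f : Fin n → F) → ∑ R (λ i → - f i) ≈ - ∑ R f
  ∑-neg f = begin
    ∑ R (λ i → - f i)      ≈⟨ ∑-cong (λ i → -1*x≈-x (f i)) ⟨
    ∑ R (λ i → - 1# * f i) ≈⟨ *-distribˡ-∑ (- 1#) f ⟨
    - 1# * ∑ R f          ≈⟨ -1*x≈-x _ ⟩
    - ∑ R f               ∎

  ∑[f-g]≈∑f-∑g : ∀ {n} (f g : Fin n → F) → ∑ R (λ i → f i - g i) ≈ ∑ R f - ∑ R g
  ∑[f-g]≈∑f-∑g f g = trans (∑-distrib-+ f (λ i → - g i)) (+-congˡ (∑-neg g))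

  x+y≈z⇒y≈z-x : ∀ {x y z} → x + y ≈ z → y ≈ z - x
  x+y≈z⇒y≈z-x {x} {y} {z} x+y≈z = begin
    y            ≈⟨ +-identityʳ y ⟨
    y + 0#       ≈⟨ +-congˡ (-‿inverseʳ x) ⟨
    y + (x - x)  ≈⟨ +-assoc y x (- x) ⟨
    (y + x) - x  ≈⟨ +-congʳ (trans (+-comm y x) x+y≈z) ⟩
    z - x        ∎

  x-y+y≈x : ∀ x y → (x - y) + y ≈ x
  x-y+y≈x x y = trans (+-assoc x (- y) y) (trans (+-congˡ (-‿inverseˡ y)) (+-identityʳ x))

  pow-cong : ∀ {x y} n → x ≈ y → pow R x n ≈ pow R y n
  pow-cong zero x≈y = refl
  pow-cong (suc n) x≈y = *-cong x≈y (pow-cong n x≈y)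

  pow-+ : ∀ x m n → pow R x (m ℕ.+ n) ≈ pow R x m * pow R x n
  pow-+ x m n = begin
    pow R x (m ℕ.+ n) ≡⟨ pow≡^ x (m ℕ.+ n) ⟩
    x ^ (m ℕ.+ n) ≈⟨ ^-homo-* x m n ⟩
    x ^ m * x ^ n ≡⟨ ≡.cong₂ _*_ (pow≡^ x m) (pow≡^ x n) ⟨
    pow R x m * pow R x n ∎

  pow-* : ∀ x m n → pow R x (m ℕ.* n) ≈ pow R (pow R x m) n
  pow-* x m n = begin
    pow R x (m ℕ.* n) ≡⟨ pow≡^ x (m ℕ.* n) ⟩
    x ^ (m ℕ.* n) ≈⟨ ^-assocʳ x m n ⟨
    (x ^ m) ^ n ≡⟨ ≡.trans (≡.cong (λ y → pow R y n) (pow≡^ x m)) (pow≡^ (x ^ m) n) ⟨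
    pow R (pow R x m) n ∎

  pow-1# : ∀ n → pow R 1# n ≈ 1#
  pow-1# zero = refl
  pow-1# (suc n) = trans (*-identityˡ _) (pow-1# n)

  ×≈fromℕ* : ∀ m y → m Mult.× y ≈ fromℕ R m * y
  ×≈fromℕ* m y = begin
    m Mult.× y ≈⟨ Mult.×-congʳ m (*-identityˡ y) ⟨
    m Mult.× (1# * y) ≈⟨ Mult.×-assoc-* m 1# y ⟨
    (m Mult.× 1#) * y ≡⟨ ≡.cong (_* y) (fromℕ≡×1# m) ⟨
    fromℕ R m * y ∎

  ∑ℕ : ℕ → (ℕ → F) → F
  ∑ℕ n g = ∑ R {n} (g ∘ toℕ)

  ∑ℕ-last : ∀ n g → ∑ℕ (suc n) g ≈ ∑ℕ n g + g n
  ∑ℕ-last zero g = trans (+-identityʳ _) (sym (+-identityˡ _))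
  ∑ℕ-last (suc n) g = trans (+-congˡ (∑ℕ-last n (g ∘ suc))) (sym (+-assoc _ _ _))

  binomial : ∀ x n → pow R (x + 1#) n ≈ ∑ℕ (suc n) (λ j → fromℕ R (n C j) * pow R x j)
  binomial x n = begin
    pow R (x + 1#) n ≡⟨ pow≡^ (x + 1#) n ⟩
    (x + 1#) ^ n ≈⟨ Binomial.theorem n x 1# ⟩
    sum (Binomial.binomialTerm x 1# n) ≡⟨ ∑≡sum (Binomial.binomialTerm x 1# n) ⟨
    ∑ R (Binomial.binomialTerm x 1# n) ≈⟨ ∑-cong {suc n} term ⟩
    ∑ R {suc n} (λ j → fromℕ R (n C toℕ j) * pow R x (toℕ j)) ∎
    where
    term : ∀ j → Binomial.binomialTerm x 1# n j ≈ fromℕ R (n C toℕ j) * pow R x (toℕ j)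
    term j = begin
      (n C toℕ j) Mult.× (x ^ toℕ j * 1# ^ (n ∸ toℕ j))
        ≈⟨ Mult.×-congʳ (n C toℕ j) (*-cong (reflexive (≡.sym (pow≡^ x (toℕ j))))
                                              (trans (reflexive (≡.sym (pow≡^ 1# (n ∸ toℕ j)))) (pow-1# (n ∸ toℕ j)))) ⟩
      (n C toℕ j) Mult.× (pow R x (toℕ j) * 1#) ≈⟨ Mult.×-congʳ (n C toℕ j) (*-identityʳ _) ⟩
      (n C toℕ j) Mult.× pow R x (toℕ j) ≈⟨ ×≈fromℕ* (n C toℕ j) _ ⟩
      fromℕ R (n C toℕ j) * pow R x (toℕ j) ∎


module FieldProperties {c ℓ} (R : CommutativeRing c ℓ) (fld : IsField R) where

  open CommutativeRing R renaming (Carrier to F) hiding (zero)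
  open import Relation.Binary.Reasoning.Setoid setoid
  open import Algebra.Properties.Ring ring using (x[y-z]≈xy-xz)
  open import Algebra.Properties.Group +-group using (x∙y⁻¹≈ε⇒x≈y; x≈y⇒x∙y⁻¹≈ε)

  1≉0 : ¬ (1# ≈ 0#)
  1≉0 = proj₁ fld

  inv : (x : F) → ¬ (x ≈ 0#) → F
  inv x x≉0 = proj₁ (proj₂ fld x x≉0)

  *-inverseʳ : ∀ x (x≉0 : ¬ (x ≈ 0#)) → x * inv x x≉0 ≈ 1#
  *-inverseʳ x x≉0 = proj₂ (proj₂ fld x x≉0)

  *-inverseˡ : ∀ x (x≉0 : ¬ (x ≈ 0#)) → inv x x≉0 * x ≈ 1#
  *-inverseˡ x x≉0 = trans (*-comm _ _) (*-inverseʳ x x≉0)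

  *-cancelˡ-≈0 : ∀ {x y} → ¬ (x ≈ 0#) → x * y ≈ 0# → y ≈ 0#
  *-cancelˡ-≈0 {x} {y} x≉0 xy≈0 = begin
    y                  ≈⟨ *-identityˡ y ⟨
    1# * y             ≈⟨ *-congʳ (*-inverseˡ x x≉0) ⟨
    inv x x≉0 * x * y   ≈⟨ *-assoc _ _ _ ⟩
    inv x x≉0 * (x * y) ≈⟨ *-congˡ xy≈0 ⟩
    inv x x≉0 * 0#      ≈⟨ zeroʳ _ ⟩
    0#                 ∎

  *-cancelˡ : ∀ {x y z} → ¬ (x ≈ 0#) → x * y ≈ x * z → y ≈ z
  *-cancelˡ {x} {y} {z} x≉0 xy≈xz =
    x∙y⁻¹≈ε⇒x≈y y z (*-cancelˡ-≈0 x≉0 (trans (x[y-z]≈xy-xz x y z) (x≈y⇒x∙y⁻¹≈ε xy≈xz)))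

  *-≉0 : ∀ {x y} → ¬ (x ≈ 0#) → ¬ (y ≈ 0#) → ¬ (x * y ≈ 0#)
  *-≉0 x≉0 y≉0 xy≈0 = y≉0 (*-cancelˡ-≈0 x≉0 xy≈0)

  pow-≉0 : ∀ {x} n → ¬ (x ≈ 0#) → ¬ (pow R x n ≈ 0#)
  pow-≉0 zero x≉0 = 1≉0
  pow-≉0 (suc n) x≉0 = *-≉0 x≉0 (pow-≉0 n x≉0)


module LinearAlgebra {c ℓ} (R : CommutativeRing c ℓ) (fld : IsField R) {q : ℕ} (card : HasCard R q) where

  open CommutativeRing R renaming (Carrier to F) hiding (zero)
  open import Relation.Binary.Reasoning.Setoid setoid
  open import Algebra.Properties.Ring ring using (-‿distribˡ-*; -‿distribʳ-*; x[y-z]≈xy-xz)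
  open import Algebra.Properties.Group +-group using (inverseˡ-unique; inverseʳ-unique; ⁻¹-involutive)
  open import Algebra.Properties.CommutativeSemigroup *-commutativeSemigroup using () renaming (interchange to *-interchange)
  open RingProperties R
  open FieldProperties R fld

  private
    enum = proj₁ card
    enum-injective = proj₁ (proj₂ card)
    index : F → Fin q
    index x = proj₁ (proj₂ (proj₂ card) x)
    enum-index : ∀ x → enum (index x) ≈ x
    enum-index x = proj₂ (proj₂ (proj₂ card) x)

  _≟_ : ∀ x y → Dec (x ≈ y)
  x ≟ y with index x Finₚ.≟ index y
  ... | yes i≡j = yes (trans (sym (enum-index x)) (trans (reflexive (≡.cong enum i≡j)) (enum-index y)))
  ... | no i≢j = no λ x≈y → i≢j (enum-injective _ _ (trans (enum-index x) (trans x≈y (sym (enum-index y)))))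

  ≈-stable : ∀ {x y} → ¬ ¬ (x ≈ y) → x ≈ y
  ≈-stable {x} {y} = decidable-stable (x ≟ y)

  lincomb : ∀ {m K} → (Fin m → F) → (Fin m → Fin K → F) → Fin K → F
  lincomb cf v i = ∑ R (λ j → cf j * v j i)

  lincomb-congʳ : ∀ {m K} (cf : Fin m → F) {v w : Fin m → Fin K → F} → (∀ j i → v j i ≈ w j i) →
                  ∀ i → lincomb cf v i ≈ lincomb cf w i
  lincomb-congʳ cf v≈w i = ∑-cong (λ j → *-congˡ (v≈w j i))

  LinDep : ∀ {m K} → (Fin m → Fin K → F) → Set (c ⊔ ℓ)
  LinDep {m} v = Σ (Fin m → F) λ cf → (∀ i → lincomb cf v i ≈ 0#) × ∃ λ l → ¬ (cf l ≈ 0#)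

  LinDep-zero-column : ∀ {m n} (v : Fin m → Fin (suc n) → F) → (∀ l → v l Fin.zero ≈ 0#) →
                       LinDep (λ l p → v l (Fin.suc p)) → LinDep v
  LinDep-zero-column {m} v v≈0 (cf , comb , nonzero) = cf , comb′ , nonzero
    where
    comb′ : ∀ i → lincomb cf v i ≈ 0#
    comb′ Fin.zero = trans (∑-cong (λ l → trans (*-congˡ (v≈0 l)) (zeroʳ _))) (∑-zero m)
    comb′ (Fin.suc p) = comb p

  module Elimination {m n} (v : Fin (suc m) → Fin (suc n) → F)
                     (l₀ : Fin (suc m)) (pivot≉0 : ¬ (v l₀ Fin.zero ≈ 0#)) where

    pivot⁻¹ : F
    pivot⁻¹ = inv (v l₀ Fin.zero) pivot≉0

    others : Fin m → Fin (suc n) → F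
    others = v ∘ punchIn l₀

    reduced : Fin m → Fin n → F
    reduced l p = others l (Fin.suc p) - others l Fin.zero * pivot⁻¹ * v l₀ (Fin.suc p)

    lift : LinDep reduced → LinDep v
    lift (cf′ , comb′ , l₁ , cf′≉0) = cf , comb , punchIn l₀ l₁ , cf≉0
      where
      s₀ = lincomb cf′ others Fin.zero
      x = - (s₀ * pivot⁻¹)
      cf = Vec.insertAt cf′ l₀ x

      cf≉0 : ¬ (cf (punchIn l₀ l₁) ≈ 0#)
      cf≉0 = cf′≉0 ∘ trans (reflexive (≡.sym (Vecₚ.insertAt-punchIn cf′ l₀ x l₁)))

      split : ∀ p → lincomb cf v p ≈ x * v l₀ p + lincomb cf′ others p
      split p = trans (∑-remove l₀ (λ l → cf l * v l p))
        (+-cong (reflexive (≡.cong (_* v l₀ p) (Vecₚ.insertAt-lookup cf′ l₀ x)))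
                (∑-cong (λ l → reflexive (≡.cong (_* others l p) (Vecₚ.insertAt-punchIn cf′ l₀ x l)))))

      x*pivot : x * v l₀ Fin.zero ≈ - s₀
      x*pivot = begin
        - (s₀ * pivot⁻¹) * v l₀ Fin.zero ≈⟨ -‿distribˡ-* _ _ ⟨
        - (s₀ * pivot⁻¹ * v l₀ Fin.zero) ≈⟨ -‿cong (*-assoc _ _ _) ⟩
        - (s₀ * (pivot⁻¹ * v l₀ Fin.zero)) ≈⟨ -‿cong (*-congˡ (*-inverseˡ _ pivot≉0)) ⟩
        - (s₀ * 1#)                     ≈⟨ -‿cong (*-identityʳ s₀) ⟩
        - s₀                            ∎

      reduced-comb : ∀ q → lincomb cf′ reduced q ≈ lincomb cf′ others (Fin.suc q) + x * v l₀ (Fin.suc q)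
      reduced-comb q = begin
        lincomb cf′ reduced q
          ≈⟨ ∑-cong (λ l → x[y-z]≈xy-xz (cf′ l) (others l (Fin.suc q)) (others l Fin.zero * pivot⁻¹ * b)) ⟩
        ∑ R (λ l → cf′ l * others l (Fin.suc q) - cf′ l * (others l Fin.zero * pivot⁻¹ * b))
          ≈⟨ ∑[f-g]≈∑f-∑g (λ l → cf′ l * others l (Fin.suc q)) (λ l → cf′ l * (others l Fin.zero * pivot⁻¹ * b)) ⟩
        t - ∑ R (λ l → cf′ l * (others l Fin.zero * pivot⁻¹ * b))
          ≈⟨ +-congˡ (-‿cong (∑-cong (λ l → trans (*-congˡ (*-assoc (others l Fin.zero) pivot⁻¹ b))
                                                   (sym (*-assoc (cf′ l) (others l Fin.zero) (pivot⁻¹ * b)))))) ⟩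
        t - ∑ R (λ l → cf′ l * others l Fin.zero * (pivot⁻¹ * b))
          ≈⟨ +-congˡ (-‿cong (*-distribʳ-∑ (pivot⁻¹ * b) (λ l → cf′ l * others l Fin.zero))) ⟨
        t - s₀ * (pivot⁻¹ * b)
          ≈⟨ +-congˡ (-‿cong (*-assoc _ _ _)) ⟨
        t - s₀ * pivot⁻¹ * b
          ≈⟨ +-congˡ (-‿distribˡ-* _ _) ⟩
        t + x * b ∎
        where
        b = v l₀ (Fin.suc q)
        t = lincomb cf′ others (Fin.suc q)

      comb : ∀ p → lincomb cf v p ≈ 0#
      comb Fin.zero = trans (split Fin.zero) (trans (+-congʳ x*pivot) (-‿inverseˡ s₀))
      comb (Fin.suc q) = trans (split (Fin.suc q)) (trans (+-comm _ _) (trans (sym (reduced-comb q)) (comb′ q)))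

  n<m⇒LinDep : ∀ {m n} → n ℕ.< m → (v : Fin m → Fin n → F) → LinDep v
  n<m⇒LinDep {suc m} {zero} _ v = (λ _ → 1#) , (λ ()) , Fin.zero , 1≉0
  n<m⇒LinDep {suc m} {suc n} (ℕ.s≤s n<m) v with Finₚ.any? (λ l → ¬? (v l Fin.zero ≟ 0#))
  ... | yes (l₀ , pivot≉0) = Elimination.lift v l₀ pivot≉0 (n<m⇒LinDep n<m (Elimination.reduced v l₀ pivot≉0))
  ... | no noPivot = LinDep-zero-column v (λ l → ≈-stable (λ v≉0 → noPivot (l , v≉0)))
                       (n<m⇒LinDep (ℕₚ.m<n⇒m<1+n n<m) (λ l p → v l (Fin.suc p)))

  InSpan : ∀ {m n K} → (Fin m → Fin K → F) → (Fin n → Fin K → F) → Set (c ⊔ ℓ)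
  InSpan {m} {n} u w = Σ (Fin m → Fin n → F) λ A → ∀ l i → u l i ≈ lincomb (A l) w i

  lincomb-assoc : ∀ {m n K} (cf : Fin m → F) (A : Fin m → Fin n → F) (w : Fin n → Fin K → F) i →
                  lincomb cf (λ l → lincomb (A l) w) i ≈ lincomb (lincomb cf A) w i
  lincomb-assoc cf A w i = begin
    ∑ R (λ l → cf l * ∑ R (λ p → A l p * w p i))     ≈⟨ ∑-cong (λ l → *-distribˡ-∑ (cf l) (λ p → A l p * w p i)) ⟩
    ∑ R (λ l → ∑ R (λ p → cf l * (A l p * w p i)))   ≈⟨ ∑-comm (λ l p → cf l * (A l p * w p i)) ⟩
    ∑ R (λ p → ∑ R (λ l → cf l * (A l p * w p i)))   ≈⟨ ∑-cong (λ p → ∑-cong (λ l → *-assoc (cf l) (A l p) (w p i))) ⟨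
    ∑ R (λ p → ∑ R (λ l → cf l * A l p * w p i))     ≈⟨ ∑-cong (λ p → *-distribʳ-∑ (w p i) (λ l → cf l * A l p)) ⟨
    ∑ R (λ p → ∑ R (λ l → cf l * A l p) * w p i)     ∎

  InSpan-trans : ∀ {m n o K} {u : Fin m → Fin K → F} {v : Fin n → Fin K → F} {w : Fin o → Fin K → F} →
                 InSpan u v → InSpan v w → InSpan u w
  InSpan-trans {w = w} (A , u≈) (B , v≈) =
    (λ l → lincomb (A l) B) , λ l i → trans (u≈ l i) (trans (lincomb-congʳ (A l) v≈ i) (lincomb-assoc (A l) B w i))

  LinIndep∧InSpan⇒≤ : ∀ {m n K} {u : Fin m → Fin K → F} {w : Fin n → Fin K → F} →
                      LinIndep R u → InSpan u w → m ℕ.≤ n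
  LinIndep∧InSpan⇒≤ {m} {n} {u = u} {w} indep (A , u≈) with m ℕ.≤? n
  ... | yes m≤n = m≤n
  ... | no m≰n = ⊥-elim (cf≉0 (indep cf comb l))
    where
    dep = n<m⇒LinDep (ℕₚ.≰⇒> m≰n) A
    cf = proj₁ dep
    l = proj₁ (proj₂ (proj₂ dep))
    cf≉0 = proj₂ (proj₂ (proj₂ dep))
    comb : ∀ i → lincomb cf u i ≈ 0#
    comb i = begin
      lincomb cf u i                        ≈⟨ lincomb-congʳ cf u≈ i ⟩
      lincomb cf (λ l → lincomb (A l) w) i ≈⟨ lincomb-assoc cf A w i ⟩
      lincomb (lincomb cf A) w i           ≈⟨ ∑-cong (λ p → trans (*-congʳ (proj₁ (proj₂ dep) p)) (zeroˡ _)) ⟩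
      ∑ R {n} (λ _ → 0#)                    ≈⟨ ∑-zero n ⟩
      0#                                   ∎

  ∃-vector? : ∀ m {p} (Q : (Fin m → F) → Set p) → (∀ {f g} → (∀ i → f i ≈ g i) → Q f → Q g) →
              (∀ f → Dec (Q f)) → Dec (∃ Q)
  ∃-vector? zero Q resp Q? with Q? (λ ())
  ... | yes Qf = yes (_ , Qf)
  ... | no ¬Qf = no λ (f , Qf) → ¬Qf (resp (λ ()) Qf)
  ∃-vector? (suc m) Q resp Q? with Finₚ.any? (λ i → ∃-vector? m (Q ∘ (enum i Vec.∷_)) (resp ∘ ∷-cong) (Q? ∘ (enum i Vec.∷_)))
    where
    ∷-cong : ∀ {x} {f g : Fin m → F} → (∀ i → f i ≈ g i) → ∀ i → (x Vec.∷ f) i ≈ (x Vec.∷ g) i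
    ∷-cong f≈g Fin.zero = refl
    ∷-cong f≈g (Fin.suc i) = f≈g i
  ... | yes (_ , _ , Qg) = yes (_ , Qg)
  ... | no none = no λ (f , Qf) → none (index (f Fin.zero) , f ∘ Fin.suc , resp (head≈ f) Qf)
    where
    head≈ : ∀ f i → f i ≈ (enum (index (f Fin.zero)) Vec.∷ f ∘ Fin.suc) i
    head≈ f Fin.zero = sym (enum-index (f Fin.zero))
    head≈ f (Fin.suc i) = refl

  LinIndep⊎LinDep : ∀ {m K} (v : Fin m → Fin K → F) → LinIndep R v ⊎ LinDep v
  LinIndep⊎LinDep {m} v with ∃-vector? m IsDependence resp IsDependence?
    where
    IsDependence : (Fin m → F) → Set ℓ
    IsDependence cf = (∀ i → lincomb cf v i ≈ 0#) × ∃ λ l → ¬ (cf l ≈ 0#)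
    resp : ∀ {f g} → (∀ i → f i ≈ g i) → IsDependence f → IsDependence g
    resp f≈g (comb , l , f≉0) = (λ i → trans (∑-cong (λ j → *-congʳ (sym (f≈g j)))) (comb i)) , l , f≉0 ∘ trans (f≈g l)
    IsDependence? : ∀ cf → Dec (IsDependence cf)
    IsDependence? cf = Finₚ.all? (λ i → lincomb cf v i ≟ 0#) ×-dec Finₚ.any? (λ l → ¬? (cf l ≟ 0#))
  ... | yes dep = inj₂ dep
  ... | no ¬dep = inj₁ λ cf comb j → ≈-stable λ cf≉0 → ¬dep (cf , comb , j , cf≉0)

  ¬LinIndep-∷⇒lincomb : ∀ {r K} {v : Fin r → Fin K → F} {x : Fin K → F} →
                        LinIndep R v → ¬ LinIndep R (x Vec.∷ v) → Σ (Fin r → F) λ cf → ∀ i → x i ≈ lincomb cf v i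
  ¬LinIndep-∷⇒lincomb {K = K} {v = v} {x} indep ¬indep with LinIndep⊎LinDep (x Vec.∷ v)
  ... | inj₁ indep′ = ⊥-elim (¬indep indep′)
  ... | inj₂ (cf , comb , l , cf≉0) = (λ p → - (c₀⁻¹ * cf (Fin.suc p))) , x≈
    where
    c₀ = cf Fin.zero
    rest : Fin K → F
    rest = lincomb (cf ∘ Fin.suc) v

    c₀≉0 : ¬ (c₀ ≈ 0#)
    c₀≉0 c₀≈0 = cf≉0 (all≈0 l)
      where
      rest≈0 : ∀ i → rest i ≈ 0#
      rest≈0 i = trans (sym (+-identityˡ _)) (trans (+-congʳ (sym (trans (*-congʳ c₀≈0) (zeroˡ (x i))))) (comb i))
      all≈0 : ∀ l → cf l ≈ 0#
      all≈0 Fin.zero = c₀≈0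
      all≈0 (Fin.suc p) = indep (cf ∘ Fin.suc) rest≈0 p

    c₀⁻¹ = inv c₀ c₀≉0

    x≈ : ∀ i → x i ≈ lincomb (λ p → - (c₀⁻¹ * cf (Fin.suc p))) v i
    x≈ i = begin
      x i                    ≈⟨ *-identityˡ _ ⟨
      1# * x i               ≈⟨ *-congʳ (*-inverseˡ c₀ c₀≉0) ⟨
      c₀⁻¹ * c₀ * x i        ≈⟨ *-assoc _ _ _ ⟩
      c₀⁻¹ * (c₀ * x i)      ≈⟨ *-congˡ (inverseˡ-unique _ _ (comb i)) ⟩
      c₀⁻¹ * - rest i        ≈⟨ -‿distribʳ-* _ _ ⟨
      - (c₀⁻¹ * rest i)      ≈⟨ -‿cong (*-distribˡ-∑ c₀⁻¹ (λ p → cf (Fin.suc p) * v p i)) ⟩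
      - ∑ R (λ p → c₀⁻¹ * (cf (Fin.suc p) * v p i)) ≈⟨ ∑-neg (λ p → c₀⁻¹ * (cf (Fin.suc p) * v p i)) ⟨
      ∑ R (λ p → - (c₀⁻¹ * (cf (Fin.suc p) * v p i)))
        ≈⟨ ∑-cong (λ p → trans (-‿cong (sym (*-assoc _ _ _))) (-‿distribˡ-* (c₀⁻¹ * cf (Fin.suc p)) (v p i))) ⟩
      lincomb (λ p → - (c₀⁻¹ * cf (Fin.suc p))) v i ∎

  columns : ∀ {K n r} → (Fin K → Fin n → F) → (Fin r → Fin n) → Fin r → Fin K → F
  columns M σ p i = M i (σ p)

  maximal-LinIndep⇒InSpan : ∀ {K n r} (M : Fin K → Fin n → F) (σ : Fin r → Fin n) →
    LinIndep R (columns M σ) → (∀ (σ′ : Fin (suc r) → Fin n) → ¬ LinIndep R (columns M σ′)) →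
    InSpan (columns M id) (columns M σ)
  maximal-LinIndep⇒InSpan M σ indep maximal =
    (λ j → proj₁ (in-span j)) , λ j → proj₂ (in-span j)
    where
    in-span : ∀ j → Σ _ λ cf → ∀ i → M i j ≈ lincomb cf (columns M σ) i
    in-span j = ¬LinIndep-∷⇒lincomb indep (maximal (j Vec.∷ σ))


  δ : ∀ {m} → Fin m → Fin m → F
  δ i j with i Finₚ.≟ j
  ... | yes _ = 1#
  ... | no _ = 0#

  δ-diag : ∀ {m} (i : Fin m) → δ i i ≈ 1#
  δ-diag i with i Finₚ.≟ i
  ... | yes _ = refl
  ... | no i≢i = ⊥-elim (i≢i ≡.refl)

  δ-off : ∀ {m} {i j : Fin m} → i ≢ j → δ i j ≈ 0#
  δ-off {i = i} {j} i≢j with i Finₚ.≟ j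
  ... | yes i≡j = ⊥-elim (i≢j i≡j)
  ... | no _ = refl

  ∑-δ : ∀ {m} (f : Fin m → F) (i : Fin m) → ∑ R (λ p → f p * δ p i) ≈ f i
  ∑-δ f i = trans (∑-single i (λ p → f p * δ p i) (λ p p≢i → trans (*-congˡ (δ-off p≢i)) (zeroʳ _)))
                  (trans (*-congˡ (δ-diag i)) (*-identityʳ _))

  InSpan-δ : ∀ {m K} (u : Fin m → Fin K → F) → InSpan u δ
  InSpan-δ u = u , λ l i → sym (∑-δ (u l) i)

  LinIndep⇒lincomb : ∀ {K} {v : Fin K → Fin K → F} → LinIndep R v → ∀ x → Σ (Fin K → F) λ cf → ∀ i → x i ≈ lincomb cf v i
  LinIndep⇒lincomb indep x = ¬LinIndep-∷⇒lincomb indep λ indep′ →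
    ℕₚ.<-irrefl ≡.refl (LinIndep∧InSpan⇒≤ indep′ (InSpan-δ (x Vec.∷ _)))

  LinIndep-transpose : ∀ {K} (M : Fin K → Fin K → F) → LinIndep R (λ i t → M t i) → LinIndep R M
  LinIndep-transpose {suc k} M rows-indep cf comb l = ≈-stable λ cf≉0 →
    ℕₚ.<-irrefl ≡.refl (LinIndep∧InSpan⇒≤ rows-indep (rows-in-span cf≉0))
    where
    -- The relation expresses M l through the other vectors, so every row (M t i)ₜ lies in
    -- the span of the k vectors δ (punchIn l u) − (cf (punchIn l u) / cf l) δ l.
    rows-in-span : (cf≉0 : ¬ (cf l ≈ 0#)) →
                   InSpan (λ i t → M t i) (λ u t → δ (punchIn l u) t - cf (punchIn l u) * inv (cf l) cf≉0 * δ l t)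
    rows-in-span cf≉0 = (λ i u → M (punchIn l u) i) , row≈
      where
      c⁻¹ = inv (cf l) cf≉0
      row≈ : ∀ i t → M t i ≈ ∑ R (λ u → M (punchIn l u) i * (δ (punchIn l u) t - cf (punchIn l u) * c⁻¹ * δ l t))
      row≈ i t = sym (begin
        ∑ R (λ u → m u * (d u - a u * c⁻¹ * δ l t))
          ≈⟨ ∑-cong (λ u → x[y-z]≈xy-xz (m u) (d u) (a u * c⁻¹ * δ l t)) ⟩
        ∑ R (λ u → m u * d u - m u * (a u * c⁻¹ * δ l t))
          ≈⟨ ∑[f-g]≈∑f-∑g (λ u → m u * d u) (λ u → m u * (a u * c⁻¹ * δ l t)) ⟩
        ∑ R (λ u → m u * d u) - ∑ R (λ u → m u * (a u * c⁻¹ * δ l t))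
          ≈⟨ +-cong others-δ (-‿cong (∑-cong λ u → rearrange (m u) (a u) c⁻¹ (δ l t))) ⟩
        (M t i - M l i * δ l t) - ∑ R (λ u → a u * m u * (c⁻¹ * δ l t))
          ≈⟨ +-congˡ (-‿cong (*-distribʳ-∑ (c⁻¹ * δ l t) (λ u → a u * m u))) ⟨
        (M t i - M l i * δ l t) - ∑ R (λ u → a u * m u) * (c⁻¹ * δ l t)
          ≈⟨ +-congˡ (-‿cong (*-congʳ others-comb)) ⟩
        (M t i - M l i * δ l t) - - (cf l * M l i) * (c⁻¹ * δ l t)
          ≈⟨ +-congˡ (cancel (M l i) (δ l t)) ⟩
        (M t i - M l i * δ l t) + M l i * δ l t              ≈⟨ x-y+y≈x _ _ ⟩
        M t i                                                ∎)
        where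
        m a d : Fin k → F
        m u = M (punchIn l u) i
        a u = cf (punchIn l u)
        d u = δ (punchIn l u) t
        others-δ : ∑ R (λ u → m u * d u) ≈ M t i - M l i * δ l t
        others-δ = x+y≈z⇒y≈z-x (trans (sym (∑-remove l (λ p → M p i * δ p t))) (∑-δ (λ p → M p i) t))
        others-comb : ∑ R (λ u → a u * m u) ≈ - (cf l * M l i)
        others-comb = inverseʳ-unique _ _ (trans (sym (∑-remove l (λ p → cf p * M p i))) (comb i))
        rearrange : ∀ x y z w → x * (y * z * w) ≈ y * x * (z * w)
        rearrange x y z w = trans (*-congˡ (*-assoc y z w)) (trans (sym (*-assoc x y (z * w))) (*-congʳ (*-comm x y)))
        cancel : ∀ x w → - (- (cf l * x) * (c⁻¹ * w)) ≈ x * w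
        cancel x w = begin
          - (- (cf l * x) * (c⁻¹ * w)) ≈⟨ -‿cong (-‿distribˡ-* _ _) ⟨
          - - (cf l * x * (c⁻¹ * w))   ≈⟨ ⁻¹-involutive _ ⟩
          cf l * x * (c⁻¹ * w)        ≈⟨ *-interchange (cf l) x c⁻¹ w ⟩
          cf l * c⁻¹ * (x * w)        ≈⟨ *-congʳ (*-inverseʳ (cf l) cf≉0) ⟩
          1# * (x * w)                ≈⟨ *-identityˡ _ ⟩
          x * w                       ∎


module Enumerations {c ℓ} (R : CommutativeRing c ℓ) where

  open CommutativeRing R renaming (Carrier to F) hiding (zero)
  open RingProperties R

  -- {t | P t} listed in increasing order; ∑-embed holds by construction and is recorded with it
  record Enumeration {p} (k : ℕ) (P : Fin k → Set p) : Set (p ⊔ c ⊔ ℓ) where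
    field
      size : ℕ
      embed : Fin size → Fin k
      embed-injective : Injective _≡_ _≡_ embed
      embed-∈ : ∀ i → P (embed i)
      embed-surjective : ∀ t → P t → ∃ λ i → embed i ≡ t
      ∑-embed : ∀ (g : Fin k → F) → (∀ t → ¬ P t → g t ≈ 0#) → ∑ R g ≈ ∑ R (g ∘ embed)

  open Enumeration public

  private
    variable
      p : Level
      k : ℕ
      P : Fin (suc k) → Set p

  empty : ∀ {P : Fin 0 → Set p} → Enumeration 0 P
  empty = record { size = 0 ; embed = λ () ; embed-injective = λ {} ; embed-∈ = λ () ; embed-surjective = λ () ; ∑-embed = λ _ _ → refl }

  cons-zero : P Fin.zero → Enumeration k (P ∘ Fin.suc) → Enumeration (suc k) P
  cons-zero P0 A = record
    { size = suc (size A)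
    ; embed = Fin.zero Vec.∷ (Fin.suc ∘ embed A)
    ; embed-injective = λ { {Fin.zero} {Fin.zero} _ → ≡.refl
                          ; {Fin.suc i} {Fin.suc j} eq → ≡.cong Fin.suc (embed-injective A (Finₚ.suc-injective eq)) }
    ; embed-∈ = λ { Fin.zero → P0 ; (Fin.suc i) → embed-∈ A i }
    ; embed-surjective = λ { Fin.zero _ → Fin.zero , ≡.refl
                           ; (Fin.suc t) Pt → Fin.suc (proj₁ (embed-surjective A t Pt)) , ≡.cong Fin.suc (proj₂ (embed-surjective A t Pt)) }
    ; ∑-embed = λ g g≈0 → +-congˡ (∑-embed A (g ∘ Fin.suc) (g≈0 ∘ Fin.suc))
    }

  skip-zero : ¬ P Fin.zero → Enumeration k (P ∘ Fin.suc) → Enumeration (suc k) P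
  skip-zero ¬P0 A = record
    { size = size A
    ; embed = Fin.suc ∘ embed A
    ; embed-injective = embed-injective A ∘ Finₚ.suc-injective
    ; embed-∈ = embed-∈ A
    ; embed-surjective = λ { Fin.zero P0 → ⊥-elim (¬P0 P0)
                           ; (Fin.suc t) Pt → proj₁ (embed-surjective A t Pt) , ≡.cong Fin.suc (proj₂ (embed-surjective A t Pt)) }
    ; ∑-embed = λ g g≈0 → trans (+-congʳ (g≈0 Fin.zero ¬P0)) (trans (+-identityˡ _) (∑-embed A (g ∘ Fin.suc) (g≈0 ∘ Fin.suc)))
    }

  partition : ∀ k {P : Fin k → Set p} → Decidable P →
              Σ (Enumeration k P) λ A → Σ (Enumeration k (¬_ ∘ P)) λ B → size A ℕ.+ size B ≡ k
  partition zero P? = empty , empty , ≡.refl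
  partition (suc k) P? with partition k (P? ∘ Fin.suc) | P? Fin.zero
  ... | A , B , sizes | yes P0 = cons-zero P0 A , skip-zero (λ ¬P0 → ¬P0 P0) B , ≡.cong suc sizes
  ... | A , B , sizes | no ¬P0 = skip-zero ¬P0 A , cons-zero ¬P0 B , ≡.trans (ℕₚ.+-suc (size A) (size B)) (≡.cong suc sizes)

  LinIndep-∘embed : ∀ {K} {P : Fin k → Set p} → Decidable P → (v : Fin k → Fin K → F) → LinIndep R v →
                    (A : Enumeration k P) → LinIndep R (v ∘ embed A)
  LinIndep-∘embed {k = k} {P = P} P? v indep A cf comb u = trans (sym (extended-embed u)) (indep extended comb′ (embed A u))
    where
    extended : Fin k → F
    extended t with P? t
    ... | yes Pt = cf (proj₁ (embed-surjective A t Pt))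
    ... | no _ = 0#
    extended-embed : ∀ u → extended (embed A u) ≈ cf u
    extended-embed u with P? (embed A u)
    ... | yes P = reflexive (≡.cong cf (embed-injective A (proj₂ (embed-surjective A (embed A u) P))))
    ... | no ¬P = ⊥-elim (¬P (embed-∈ A u))
    outside≈0 : ∀ i t → ¬ P t → extended t * v t i ≈ 0#
    outside≈0 i t ¬P with P? t
    ... | yes P = ⊥-elim (¬P P)
    ... | no _ = zeroˡ _
    comb′ : ∀ i → ∑ R (λ t → extended t * v t i) ≈ 0#
    comb′ i = trans (∑-embed A (λ t → extended t * v t i) (outside≈0 i))
                    (trans (∑-cong (λ u → *-congʳ (extended-embed u))) (comb i))


module Diagonalisable {c ℓ} (R : CommutativeRing c ℓ) (fld : IsField R) {q : ℕ} (card : HasCard R q) where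

  open CommutativeRing R renaming (Carrier to F) hiding (zero)
  open import Relation.Binary.Reasoning.Setoid setoid
  open import Algebra.Properties.CommutativeSemigroup *-commutativeSemigroup using (x∙yz≈y∙xz)
  open RingProperties R
  open FieldProperties R fld
  open LinearAlgebra R fld card
  open Enumerations R

  module _ {K} (M : Fin K → Fin K → F) (v : Fin K → Fin K → F) (μ : Fin K → F)
           (v-indep : LinIndep R v) (eigen : ∀ t i → ∑ R (λ j → M i j * v t j) ≈ v t i * μ t)
           (B : Enumeration K (λ t → ¬ (μ t ≈ 0#))) where

    private
      vB : Fin (size B) → Fin K → F
      vB = v ∘ embed B

    columns-InSpan-vB : InSpan (columns M id) vB
    columns-InSpan-vB = (λ j u → W j (embed B u) * μ (embed B u)) , column≈
      where
      W : Fin K → Fin K → F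
      W j = proj₁ (LinIndep⇒lincomb v-indep (λ j′ → δ j′ j))
      column≈ : ∀ j i → M i j ≈ ∑ R (λ u → W j (embed B u) * μ (embed B u) * vB u i)
      column≈ j i = begin
        M i j                                              ≈⟨ ∑-δ (M i) j ⟨
        ∑ R (λ j′ → M i j′ * δ j′ j)
          ≈⟨ ∑-cong (λ j′ → *-congˡ (proj₂ (LinIndep⇒lincomb v-indep (λ j′ → δ j′ j)) j′)) ⟩
        ∑ R (λ j′ → M i j′ * ∑ R (λ t → W j t * v t j′))
          ≈⟨ ∑-cong (λ j′ → *-distribˡ-∑ (M i j′) (λ t → W j t * v t j′)) ⟩
        ∑ R (λ j′ → ∑ R (λ t → M i j′ * (W j t * v t j′)))
          ≈⟨ ∑-comm (λ j′ t → M i j′ * (W j t * v t j′)) ⟩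
        ∑ R (λ t → ∑ R (λ j′ → M i j′ * (W j t * v t j′)))
          ≈⟨ ∑-cong (λ t → ∑-cong (λ j′ → x∙yz≈y∙xz (M i j′) (W j t) (v t j′))) ⟩
        ∑ R (λ t → ∑ R (λ j′ → W j t * (M i j′ * v t j′)))
          ≈⟨ ∑-cong (λ t → *-distribˡ-∑ (W j t) (λ j′ → M i j′ * v t j′)) ⟨
        ∑ R (λ t → W j t * ∑ R (λ j′ → M i j′ * v t j′))
          ≈⟨ ∑-cong (λ t → *-congˡ (trans (eigen t i) (*-comm (v t i) (μ t)))) ⟩
        ∑ R (λ t → W j t * (μ t * v t i))
          ≈⟨ ∑-cong (λ t → sym (*-assoc (W j t) (μ t) (v t i))) ⟩
        ∑ R (λ t → W j t * μ t * v t i)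
          ≈⟨ ∑-embed B (λ t → W j t * μ t * v t i)
                       (λ t μ≈0 → trans (*-congʳ (trans (*-congˡ (≈-stable μ≈0)) (zeroʳ _))) (zeroˡ _)) ⟩
        ∑ R (λ u → W j (embed B u) * μ (embed B u) * vB u i) ∎

    vB-InSpan-columns : InSpan vB (columns M id)
    vB-InSpan-columns = (λ u j → inv (μ (embed B u)) (embed-∈ B u) * vB u j) , vB≈
      where
      vB≈ : ∀ u i → vB u i ≈ ∑ R (λ j → inv (μ (embed B u)) (embed-∈ B u) * vB u j * M i j)
      vB≈ u i = begin
        v t i                                   ≈⟨ *-identityʳ _ ⟨
        v t i * 1#                              ≈⟨ *-congˡ (*-inverseʳ (μ t) λ≉0) ⟨
        v t i * (μ t * λ⁻¹)                    ≈⟨ *-assoc _ _ _ ⟨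
        v t i * μ t * λ⁻¹                      ≈⟨ *-congʳ (eigen t i) ⟨
        ∑ R (λ j → M i j * v t j) * λ⁻¹         ≈⟨ *-distribʳ-∑ λ⁻¹ (λ j → M i j * v t j) ⟩
        ∑ R (λ j → M i j * v t j * λ⁻¹)
          ≈⟨ ∑-cong (λ j → trans (*-comm (M i j * v t j) λ⁻¹)
                                 (trans (*-congˡ (*-comm (M i j) (v t j))) (sym (*-assoc λ⁻¹ (v t j) (M i j))))) ⟩
        ∑ R (λ j → λ⁻¹ * v t j * M i j)         ∎
        where
        t = embed B u
        λ≉0 = embed-∈ B u
        λ⁻¹ = inv (μ t) λ≉0

    rank≡#nonzero : ∀ {r} → Rank R M r → r ≡ size B
    rank≡#nonzero ((σ , σ-indep) , maximal) = ℕₚ.≤-antisym r≤ ≤r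
      where
      σ-InSpan-columns : InSpan (columns M σ) (columns M id)
      σ-InSpan-columns = (λ p j → δ j (σ p)) , λ p i → sym (trans (∑-cong (λ j → *-comm (δ j (σ p)) (M i j))) (∑-δ (M i) (σ p)))
      r≤ = LinIndep∧InSpan⇒≤ σ-indep (InSpan-trans σ-InSpan-columns columns-InSpan-vB)
      ≤r = LinIndep∧InSpan⇒≤ (LinIndep-∘embed (λ t → ¬? (μ t ≟ 0#)) v v-indep B)
                             (InSpan-trans vB-InSpan-columns (maximal-LinIndep⇒InSpan M σ σ-indep maximal))


module Polynomials {c ℓ} (R : CommutativeRing c ℓ) (fld : IsField R) {q : ℕ} (card : HasCard R q) where

  open CommutativeRing R renaming (Carrier to F) hiding (zero)
  open import Relation.Binary.Reasoning.Setoid setoid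
  open import Algebra.Properties.CommutativeSemigroup +-commutativeSemigroup using (interchange)
  open import Algebra.Properties.CommutativeSemigroup *-commutativeSemigroup using (x∙yz≈y∙xz)
  open import Algebra.Properties.Group +-group using (x∙y⁻¹≈ε⇒x≈y)
  open RingProperties R
  open FieldProperties R fld
  open LinearAlgebra R fld card using (_≟_; LinIndep-transpose)

  infix 4 _≋_ _∣ₚ_
  infixl 6 _+ₚ_
  infixl 7 _*ₚ_

  coeff = D.coeff R
  _≋_ = D._≋_ R
  _+ₚ_ = D._+ₚ_ R
  scale = D.scale R
  _*ₚ_ = D._*ₚ_ R
  powₚ = D.powₚ R
  constₚ = D.constₚ R
  Xₚ = D.Xₚ R
  _∣ₚ_ = D._∣ₚ_ R

  coeff-+ₚ : ∀ p p′ n → coeff (p +ₚ p′) n ≈ coeff p n + coeff p′ n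
  coeff-+ₚ [] p′ n = sym (+-identityˡ _)
  coeff-+ₚ (x ∷ p) [] n = sym (+-identityʳ _)
  coeff-+ₚ (x ∷ p) (y ∷ p′) zero = refl
  coeff-+ₚ (x ∷ p) (y ∷ p′) (suc n) = coeff-+ₚ p p′ n

  coeff-scale : ∀ a p n → coeff (scale a p) n ≈ a * coeff p n
  coeff-scale a [] n = sym (zeroʳ a)
  coeff-scale a (x ∷ p) zero = refl
  coeff-scale a (x ∷ p) (suc n) = coeff-scale a p n

  coeff-*ₚ-zero : ∀ a p p′ → coeff ((a ∷ p) *ₚ p′) 0 ≈ a * coeff p′ 0
  coeff-*ₚ-zero a p p′ = trans (coeff-+ₚ (scale a p′) (0# ∷ p *ₚ p′) 0) (trans (+-identityʳ _) (coeff-scale a p′ 0))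

  coeff-*ₚ-suc : ∀ a p p′ n → coeff ((a ∷ p) *ₚ p′) (suc n) ≈ a * coeff p′ (suc n) + coeff (p *ₚ p′) n
  coeff-*ₚ-suc a p p′ n = trans (coeff-+ₚ (scale a p′) (0# ∷ p *ₚ p′) (suc n)) (+-congʳ (coeff-scale a p′ (suc n)))

  eval : Poly R → F → F
  eval [] x = 0#
  eval (a ∷ p) x = a + x * eval p x

  eval-+ₚ : ∀ p p′ x → eval (p +ₚ p′) x ≈ eval p x + eval p′ x
  eval-+ₚ [] p′ x = sym (+-identityˡ _)
  eval-+ₚ (a ∷ p) [] x = sym (+-identityʳ _)
  eval-+ₚ (a ∷ p) (b ∷ p′) x = begin
    (a + b) + x * eval (p +ₚ p′) x          ≈⟨ +-congˡ (*-congˡ (eval-+ₚ p p′ x)) ⟩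
    (a + b) + x * (eval p x + eval p′ x)    ≈⟨ +-congˡ (distribˡ x _ _) ⟩
    (a + b) + (x * eval p x + x * eval p′ x) ≈⟨ interchange _ _ _ _ ⟩
    (a + x * eval p x) + (b + x * eval p′ x) ∎

  eval-scale : ∀ a p x → eval (scale a p) x ≈ a * eval p x
  eval-scale a [] x = sym (zeroʳ a)
  eval-scale a (b ∷ p) x = begin
    a * b + x * eval (scale a p) x ≈⟨ +-congˡ (*-congˡ (eval-scale a p x)) ⟩
    a * b + x * (a * eval p x)     ≈⟨ +-congˡ (x∙yz≈y∙xz x a _) ⟩
    a * b + a * (x * eval p x)     ≈⟨ distribˡ a _ _ ⟨
    a * (b + x * eval p x)         ∎

  eval-*ₚ : ∀ p p′ x → eval (p *ₚ p′) x ≈ eval p x * eval p′ x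
  eval-*ₚ [] p′ x = sym (zeroˡ _)
  eval-*ₚ (a ∷ p) p′ x = begin
    eval (scale a p′ +ₚ (0# ∷ p *ₚ p′)) x           ≈⟨ eval-+ₚ (scale a p′) _ x ⟩
    eval (scale a p′) x + (0# + x * eval (p *ₚ p′) x)
      ≈⟨ +-cong (eval-scale a p′ x) (trans (+-identityˡ _) (*-congˡ (eval-*ₚ p p′ x))) ⟩
    a * eval p′ x + x * (eval p x * eval p′ x)      ≈⟨ +-congˡ (*-assoc _ _ _) ⟨
    a * eval p′ x + x * eval p x * eval p′ x        ≈⟨ distribʳ _ _ _ ⟨
    (a + x * eval p x) * eval p′ x                  ∎

  IsZero : Poly R → Set ℓ
  IsZero p = ∀ n → coeff p n ≈ 0#

  eval-IsZero : ∀ p x → IsZero p → eval p x ≈ 0#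
  eval-IsZero [] x p≈0 = refl
  eval-IsZero (a ∷ p) x p≈0 =
    trans (+-cong (p≈0 0) (trans (*-congˡ (eval-IsZero p x (p≈0 ∘ suc))) (zeroʳ x))) (+-identityˡ _)

  eval-cong : ∀ {p p′} x → p ≋ p′ → eval p x ≈ eval p′ x
  eval-cong {[]} {p′} x p≋p′ = sym (eval-IsZero p′ x (sym ∘ p≋p′))
  eval-cong {a ∷ p} {[]} x p≋p′ = eval-IsZero (a ∷ p) x p≋p′
  eval-cong {a ∷ p} {b ∷ p′} x p≋p′ = +-cong (p≋p′ 0) (*-congˡ (eval-cong {p} {p′} x (p≋p′ ∘ suc)))

  IsZero-*ₚˡ : ∀ p p′ → IsZero p → IsZero (p *ₚ p′)
  IsZero-*ₚˡ [] p′ p≈0 n = refl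
  IsZero-*ₚˡ (a ∷ p) p′ p≈0 zero =
    trans (coeff-*ₚ-zero a p p′) (trans (*-congʳ (p≈0 0)) (zeroˡ _))
  IsZero-*ₚˡ (a ∷ p) p′ p≈0 (suc n) =
    trans (coeff-*ₚ-suc a p p′ n)
          (trans (+-cong (trans (*-congʳ (p≈0 0)) (zeroˡ _)) (IsZero-*ₚˡ p p′ (p≈0 ∘ suc) n)) (+-identityˡ _))

  IsZero-*ₚʳ : ∀ p p′ → IsZero p′ → IsZero (p *ₚ p′)
  IsZero-*ₚʳ [] p′ p′≈0 n = refl
  IsZero-*ₚʳ (a ∷ p) p′ p′≈0 zero =
    trans (coeff-*ₚ-zero a p p′) (trans (*-congˡ (p′≈0 0)) (zeroʳ _))
  IsZero-*ₚʳ (a ∷ p) p′ p′≈0 (suc n) =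
    trans (coeff-*ₚ-suc a p p′ n)
          (trans (+-cong (trans (*-congˡ (p′≈0 (suc n))) (zeroʳ _)) (IsZero-*ₚʳ p p′ p′≈0 n)) (+-identityˡ _))

  IsZero? : ∀ p → Dec (IsZero p)
  IsZero? [] = yes (λ n → refl)
  IsZero? (a ∷ p) with a ≟ 0# | IsZero? p
  ... | yes a≈0 | yes p≈0 = yes λ { zero → a≈0 ; (suc n) → p≈0 n }
  ... | no a≉0 | _ = no λ a∷p≈0 → a≉0 (a∷p≈0 0)
  ... | _ | no p≉0 = no λ a∷p≈0 → p≉0 (a∷p≈0 ∘ suc)

  ¬IsZero⇒Degree : ∀ p → ¬ IsZero p → ∃ (Degree R p)
  ¬IsZero⇒Degree [] p≉0 = ⊥-elim (p≉0 (λ n → refl))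
  ¬IsZero⇒Degree (a ∷ p) a∷p≉0 with IsZero? p
  ... | yes p≈0 = 0 , (λ a≈0 → a∷p≉0 λ { zero → a≈0 ; (suc n) → p≈0 n }) , λ { (suc m) _ → p≈0 m }
  ... | no p≉0 with ¬IsZero⇒Degree p p≉0
  ...   | d , lead≉0 , above≈0 = suc d , lead≉0 , λ { (suc m) (ℕ.s≤s d<m) → above≈0 m d<m }

  Degree-cong : ∀ {p p′ d} → p ≋ p′ → Degree R p d → Degree R p′ d
  Degree-cong p≋p′ (lead≉0 , above≈0) = lead≉0 ∘ trans (p≋p′ _) , λ m d<m → trans (sym (p≋p′ m)) (above≈0 m d<m)

  Degree-unique : ∀ {p d d′} → Degree R p d → Degree R p d′ → d ≡ d′
  Degree-unique {d = d} {d′} (lead≉0 , above≈0) (lead′≉0 , above′≈0) with ℕₚ.<-cmp d d′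
  ... | tri< d<d′ _ _ = ⊥-elim (lead′≉0 (above≈0 d′ d<d′))
  ... | tri≈ _ d≡d′ _ = d≡d′
  ... | tri> _ _ d′<d = ⊥-elim (lead≉0 (above′≈0 d d′<d))

  Degree⇒¬IsZero : ∀ {p d} → Degree R p d → ¬ IsZero p
  Degree⇒¬IsZero (lead≉0 , _) p≈0 = lead≉0 (p≈0 _)

  Degree-*ₚ : ∀ p p′ {d d′} → Degree R p d → Degree R p′ d′ → Degree R (p *ₚ p′) (d ℕ.+ d′)
  Degree-*ₚ [] p′ (lead≉0 , _) _ = ⊥-elim (lead≉0 refl)
  Degree-*ₚ (a ∷ p) p′ {zero} {d′} (a≉0 , above≈0) (lead′≉0 , above′≈0) =
    (λ lead≈0 → *-≉0 a≉0 lead′≉0 (trans (sym (scaled d′)) lead≈0)) ,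
    (λ m d′<m → trans (scaled m) (trans (*-congˡ (above′≈0 m d′<m)) (zeroʳ a)))
    where
    scaled : ∀ n → coeff ((a ∷ p) *ₚ p′) n ≈ a * coeff p′ n
    scaled zero = coeff-*ₚ-zero a p p′
    scaled (suc n) = trans (coeff-*ₚ-suc a p p′ n)
      (trans (+-congˡ (IsZero-*ₚˡ p p′ (λ m → above≈0 (suc m) (ℕ.s≤s ℕ.z≤n)) n)) (+-identityʳ _))
  Degree-*ₚ (a ∷ p) p′ {suc d} {d′} (lead≉0 , above≈0) deg′@(_ , above′≈0) = lead≉0′ , above≈0′
    where
    IH = Degree-*ₚ p p′ (lead≉0 , λ m d<m → above≈0 (suc m) (ℕ.s≤s d<m)) deg′

    shifted : ∀ n → d′ ℕ.< suc n → coeff ((a ∷ p) *ₚ p′) (suc n) ≈ coeff (p *ₚ p′) n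
    shifted n d′<1+n = trans (coeff-*ₚ-suc a p p′ n)
      (trans (+-congʳ (trans (*-congˡ (above′≈0 (suc n) d′<1+n)) (zeroʳ a))) (+-identityˡ _))

    d′<1+d+d′ : ∀ {n} → d ℕ.+ d′ ℕ.≤ n → d′ ℕ.< suc n
    d′<1+d+d′ d+d′≤n = ℕ.s≤s (ℕₚ.≤-trans (ℕₚ.m≤n+m d′ d) d+d′≤n)

    lead≉0′ = proj₁ IH ∘ trans (sym (shifted (d ℕ.+ d′) (d′<1+d+d′ ℕₚ.≤-refl)))
    above≈0′ : ∀ m → suc (d ℕ.+ d′) ℕ.< m → coeff ((a ∷ p) *ₚ p′) m ≈ 0#
    above≈0′ (suc m) (ℕ.s≤s d+d′<m) = trans (shifted m (d′<1+d+d′ (ℕₚ.<⇒≤ d+d′<m))) (proj₂ IH m d+d′<m)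

  linear : F → Poly R
  linear β = (- β) ∷ 1# ∷ []

  Degree-linear : ∀ β → Degree R (linear β) 1
  Degree-linear β = 1≉0 , λ { (suc zero) (ℕ.s≤s ()) ; (suc (suc m)) _ → refl }

  eval-linear : ∀ β x → eval (linear β) x ≈ x - β
  eval-linear β x = begin
    - β + x * (1# + x * 0#) ≈⟨ +-congˡ (*-congˡ (trans (+-congˡ (zeroʳ x)) (+-identityʳ _))) ⟩
    - β + x * 1#           ≈⟨ +-congˡ (*-identityʳ x) ⟩
    - β + x                ≈⟨ +-comm _ _ ⟩
    x - β                  ∎

  coeff-1#-*ₚ : ∀ u n → coeff ((1# ∷ []) *ₚ u) n ≈ coeff u n
  coeff-1#-*ₚ u n = begin
    coeff ((1# ∷ []) *ₚ u) n                 ≈⟨ coeff-+ₚ (scale 1# u) (0# ∷ []) n ⟩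
    coeff (scale 1# u) n + coeff (0# ∷ []) n ≈⟨ +-cong (coeff-scale 1# u n) (constant-zero n) ⟩
    1# * coeff u n + 0#                      ≈⟨ +-identityʳ _ ⟩
    1# * coeff u n                           ≈⟨ *-identityˡ _ ⟩
    coeff u n                                ∎
    where
    constant-zero : ∀ n → coeff (0# ∷ []) n ≈ 0#
    constant-zero zero = refl
    constant-zero (suc n) = refl

  coeff-linear-*ₚ-suc : ∀ β u n → coeff (linear β *ₚ u) (suc n) ≈ - β * coeff u (suc n) + coeff u n
  coeff-linear-*ₚ-suc β u n = trans (coeff-*ₚ-suc (- β) (1# ∷ []) u n) (+-congˡ (coeff-1#-*ₚ u n))

  divide-linear : ∀ β p → Σ (Poly R) λ quot → p ≋ (linear β *ₚ quot +ₚ constₚ (eval p β))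
  divide-linear β [] = [] , λ { zero → sym (+-identityˡ 0#) ; (suc zero) → refl ; (suc (suc n)) → refl }
  divide-linear β (a ∷ p) = (r ∷ quot) , p≋
    where
    quot = proj₁ (divide-linear β p)
    r = eval p β
    p≋ : (a ∷ p) ≋ (linear β *ₚ (r ∷ quot) +ₚ constₚ (a + β * r))
    p≋ zero = sym (begin
      coeff (linear β *ₚ (r ∷ quot)) 0 + (a + β * r) ≈⟨ +-congʳ (coeff-*ₚ-zero (- β) (1# ∷ []) (r ∷ quot)) ⟩
      - β * r + (a + β * r)                         ≈⟨ +-congˡ (+-comm _ _) ⟩
      - β * r + (β * r + a)                         ≈⟨ +-assoc _ _ _ ⟨
      (- β * r + β * r) + a
        ≈⟨ +-congʳ (trans (sym (distribʳ r (- β) β)) (trans (*-congʳ (-‿inverseˡ β)) (zeroˡ r))) ⟩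
      0# + a                                       ≈⟨ +-identityˡ a ⟩
      a                                            ∎)
    p≋ (suc n) = begin
      coeff p n                                        ≈⟨ proj₂ (divide-linear β p) n ⟩
      coeff (linear β *ₚ quot +ₚ constₚ r) n           ≈⟨ coeff-+ₚ (linear β *ₚ quot) (constₚ r) n ⟩
      coeff (linear β *ₚ quot) n + coeff (constₚ r) n  ≈⟨ shift n ⟩
      - β * coeff quot n + coeff (r ∷ quot) n          ≈⟨ coeff-linear-*ₚ-suc β (r ∷ quot) n ⟨
      coeff (linear β *ₚ (r ∷ quot)) (suc n)           ≈⟨ +-identityʳ _ ⟨
      coeff (linear β *ₚ (r ∷ quot)) (suc n) + 0#      ≈⟨ coeff-+ₚ (linear β *ₚ (r ∷ quot)) (constₚ (a + β * r)) (suc n) ⟨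
      coeff (linear β *ₚ (r ∷ quot) +ₚ constₚ (a + β * r)) (suc n) ∎
      where
      shift : ∀ n → coeff (linear β *ₚ quot) n + coeff (constₚ r) n ≈ - β * coeff quot n + coeff (r ∷ quot) n
      shift zero = +-congʳ (coeff-*ₚ-zero (- β) (1# ∷ []) quot)
      shift (suc m) = trans (+-identityʳ _) (coeff-linear-*ₚ-suc β quot m)

  factor-theorem : ∀ β p → eval p β ≈ 0# → linear β ∣ₚ p
  factor-theorem β p root = quot , λ n → sym (begin
    coeff p n                                               ≈⟨ p≋ n ⟩
    coeff (linear β *ₚ quot +ₚ constₚ (eval p β)) n          ≈⟨ coeff-+ₚ (linear β *ₚ quot) _ n ⟩
    coeff (linear β *ₚ quot) n + coeff (constₚ (eval p β)) n ≈⟨ +-congˡ (constant≈0 n) ⟩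
    coeff (linear β *ₚ quot) n + 0#                         ≈⟨ +-identityʳ _ ⟩
    coeff (linear β *ₚ quot) n                              ∎)
    where
    quot = proj₁ (divide-linear β p)
    p≋ = proj₂ (divide-linear β p)
    constant≈0 : ∀ n → coeff (constₚ (eval p β)) n ≈ 0#
    constant≈0 zero = root
    constant≈0 (suc n) = refl

  roots≤degree : ∀ {L} p {d} → Degree R p d → (ρ : Fin L → F) → Injective _≡_ _≈_ ρ →
                 (∀ i → eval p (ρ i) ≈ 0#) → L ℕ.≤ d
  roots≤degree {zero} p deg ρ ρ-inj roots = ℕ.z≤n
  roots≤degree {suc L} p {d} deg ρ ρ-inj roots = ≡.subst (suc L ℕ.≤_) (≡.sym d≡1+d′) (ℕ.s≤s IH)
    where
    ρ₀ = ρ Fin.zero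
    quot = proj₁ (factor-theorem ρ₀ p (roots Fin.zero))
    p≋ = proj₂ (factor-theorem ρ₀ p (roots Fin.zero))
    quot-deg = ¬IsZero⇒Degree quot λ quot≈0 →
      Degree⇒¬IsZero {p} deg (λ n → trans (sym (p≋ n)) (IsZero-*ₚʳ (linear ρ₀) quot quot≈0 n))
    d≡1+d′ : d ≡ suc (proj₁ quot-deg)
    d≡1+d′ = Degree-unique {p} deg
      (Degree-cong {linear ρ₀ *ₚ quot} {p} p≋ (Degree-*ₚ (linear ρ₀) quot (Degree-linear ρ₀) (proj₂ quot-deg)))
    roots′ : ∀ i → eval quot (ρ (Fin.suc i)) ≈ 0#
    roots′ i = *-cancelˡ-≈0 ρᵢ-ρ₀≉0 (begin
      (ρ (Fin.suc i) - ρ₀) * eval quot (ρ (Fin.suc i))          ≈⟨ *-congʳ (eval-linear ρ₀ _) ⟨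
      eval (linear ρ₀) (ρ (Fin.suc i)) * eval quot (ρ (Fin.suc i)) ≈⟨ eval-*ₚ (linear ρ₀) quot _ ⟨
      eval (linear ρ₀ *ₚ quot) (ρ (Fin.suc i))                    ≈⟨ eval-cong {linear ρ₀ *ₚ quot} {p} (ρ (Fin.suc i)) p≋ ⟩
      eval p (ρ (Fin.suc i))                                     ≈⟨ roots (Fin.suc i) ⟩
      0#                                                        ∎)
      where
      ρᵢ-ρ₀≉0 : ¬ (ρ (Fin.suc i) - ρ₀ ≈ 0#)
      ρᵢ-ρ₀≉0 diff≈0 with ρ-inj (x∙y⁻¹≈ε⇒x≈y _ _ diff≈0)
      ... | ()
    IH = roots≤degree quot (proj₂ quot-deg) (ρ ∘ Fin.suc) (Finₚ.suc-injective ∘ ρ-inj) roots′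

  eval-powₚ : ∀ p m x → eval (powₚ p m) x ≈ pow R (eval p x) m
  eval-powₚ p zero x = trans (+-congˡ (zeroʳ x)) (+-identityʳ _)
  eval-powₚ p (suc m) x = trans (eval-*ₚ p (powₚ p m) x) (*-congˡ (eval-powₚ p m x))

  eval-Xₚ : ∀ x → eval Xₚ x ≈ x
  eval-Xₚ x = trans (+-identityˡ _) (trans (*-congˡ (trans (+-congˡ (zeroʳ x)) (+-identityʳ _))) (*-identityʳ x))

  eval-+ₚ-constₚ : ∀ p a x → eval (p +ₚ constₚ a) x ≈ eval p x + a
  eval-+ₚ-constₚ p a x = trans (eval-+ₚ p (constₚ a) x) (+-congˡ (trans (+-congˡ (zeroʳ x)) (+-identityʳ _)))

  coeff-Xₚ-*ₚ-zero : ∀ p → coeff (Xₚ *ₚ p) 0 ≈ 0#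
  coeff-Xₚ-*ₚ-zero p = trans (coeff-*ₚ-zero 0# (1# ∷ []) p) (zeroˡ _)

  coeff-Xₚ-*ₚ-suc : ∀ p n → coeff (Xₚ *ₚ p) (suc n) ≈ coeff p n
  coeff-Xₚ-*ₚ-suc p n = trans (coeff-*ₚ-suc 0# (1# ∷ []) p n)
    (trans (+-cong (zeroˡ _) (coeff-1#-*ₚ p n)) (+-identityˡ _))

  coeff-Xₚ^-≡ : ∀ m → coeff (powₚ Xₚ m) m ≈ 1#
  coeff-Xₚ^-≡ zero = refl
  coeff-Xₚ^-≡ (suc m) = trans (coeff-Xₚ-*ₚ-suc (powₚ Xₚ m) m) (coeff-Xₚ^-≡ m)

  coeff-Xₚ^-≢ : ∀ m n → n ≢ m → coeff (powₚ Xₚ m) n ≈ 0#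
  coeff-Xₚ^-≢ zero zero 0≢0 = ⊥-elim (0≢0 ≡.refl)
  coeff-Xₚ^-≢ zero (suc n) _ = refl
  coeff-Xₚ^-≢ (suc m) zero _ = coeff-Xₚ-*ₚ-zero (powₚ Xₚ m)
  coeff-Xₚ^-≢ (suc m) (suc n) n≢m = trans (coeff-Xₚ-*ₚ-suc (powₚ Xₚ m) n) (coeff-Xₚ^-≢ m n (n≢m ∘ ≡.cong suc))

  Degree-Xₚ^-+ₚ-constₚ : ∀ m a → Degree R (powₚ Xₚ (suc m) +ₚ constₚ a) (suc m)
  Degree-Xₚ^-+ₚ-constₚ m a =
    (λ lead≈0 → 1≉0 (trans (sym (trans (coeff-top m) (coeff-Xₚ^-≡ (suc m)))) lead≈0)) ,
    (λ { (suc n) (ℕ.s≤s m<n) → trans (coeff-top n) (coeff-Xₚ^-≢ (suc m) (suc n) (ℕₚ.<⇒≢ (ℕ.s≤s m<n) ∘ ≡.sym)) })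
    where
    coeff-top : ∀ n → coeff (powₚ Xₚ (suc m) +ₚ constₚ a) (suc n) ≈ coeff (powₚ Xₚ (suc m)) (suc n)
    coeff-top n = trans (coeff-+ₚ (powₚ Xₚ (suc m)) (constₚ a) (suc n)) (+-identityʳ _)

  fromVector : ∀ {k} → (Fin k → F) → Poly R
  fromVector {zero} a = []
  fromVector {suc k} a = a Fin.zero ∷ fromVector (a ∘ Fin.suc)

  eval-fromVector : ∀ {k} (a : Fin k → F) x → eval (fromVector a) x ≈ ∑ R (λ i → a i * pow R x (toℕ i))
  eval-fromVector {zero} a x = refl
  eval-fromVector {suc k} a x = +-cong (sym (*-identityʳ _)) (begin
    x * eval (fromVector (a ∘ Fin.suc)) x                 ≈⟨ *-congˡ (eval-fromVector (a ∘ Fin.suc) x) ⟩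
    x * ∑ R (λ i → a (Fin.suc i) * pow R x (toℕ i))       ≈⟨ *-distribˡ-∑ x (λ i → a (Fin.suc i) * pow R x (toℕ i)) ⟩
    ∑ R (λ i → x * (a (Fin.suc i) * pow R x (toℕ i)))     ≈⟨ ∑-cong (λ i → x∙yz≈y∙xz x (a (Fin.suc i)) (pow R x (toℕ i))) ⟩
    ∑ R (λ i → a (Fin.suc i) * pow R x (suc (toℕ i)))     ∎)

  coeff-fromVector : ∀ {k} (a : Fin k → F) i → coeff (fromVector a) (toℕ i) ≡ a i
  coeff-fromVector a Fin.zero = ≡.refl
  coeff-fromVector a (Fin.suc i) = coeff-fromVector (a ∘ Fin.suc) i

  coeff-fromVector-≥ : ∀ {k} (a : Fin k → F) n → k ℕ.≤ n → coeff (fromVector a) n ≈ 0#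
  coeff-fromVector-≥ {zero} a n _ = refl
  coeff-fromVector-≥ {suc k} a (suc n) (ℕ.s≤s k≤n) = coeff-fromVector-≥ (a ∘ Fin.suc) n k≤n

  powers-LinIndep : ∀ {k} (β : Fin k → F) → Injective _≡_ _≈_ β → LinIndep R (λ t i → pow R (β t) (toℕ i))
  powers-LinIndep {k} β β-inj = LinIndep-transpose (λ t i → pow R (β t) (toℕ i)) coefficients≈0
    where
    -- a nonzero polynomial of degree < k cannot vanish at k distinct points
    coefficients≈0 : LinIndep R (λ i t → pow R (β t) (toℕ i))
    coefficients≈0 a roots i with IsZero? (fromVector a)
    ... | yes a≈0 = trans (reflexive (≡.sym (coeff-fromVector a i))) (a≈0 (toℕ i))
    ... | no a≉0 = ⊥-elim (ℕₚ.<⇒≱ deg<k (roots≤degree (fromVector a) (proj₂ deg) β β-inj roots′))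
      where
      deg = ¬IsZero⇒Degree (fromVector a) a≉0
      deg<k : proj₁ deg ℕ.< k
      deg<k with proj₁ deg ℕ.<? k
      ... | yes d<k = d<k
      ... | no d≮k = ⊥-elim (proj₁ (proj₂ deg) (coeff-fromVector-≥ a (proj₁ deg) (ℕₚ.≮⇒≥ d≮k)))
      roots′ : ∀ t → eval (fromVector a) (β t) ≈ 0#
      roots′ t = trans (eval-fromVector a (β t)) (roots t)


module GcdDegree {c ℓ} (R : CommutativeRing c ℓ) (fld : IsField R) {q : ℕ} (card : HasCard R q) where

  open CommutativeRing R renaming (Carrier to F) hiding (zero)
  open import Relation.Binary.Reasoning.Setoid setoid
  open FieldProperties R fld
  open Polynomials R fld card
  open Enumerations R

  gcd-degree : ∀ {K} (f g : Poly R) → Degree R g K → (β : Fin K → F) → Injective _≡_ _≈_ β →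
               (∀ t → eval g (β t) ≈ 0#) →
               (A : Enumeration K (λ t → eval f (β t) ≈ 0#)) (B : Enumeration K (λ t → ¬ (eval f (β t) ≈ 0#))) →
               size A ℕ.+ size B ≡ K → ∀ {d dg} → IsGCD R d f g → Degree R d dg → dg ≡ size A
  gcd-degree {K} f g g-deg β β-inj g-roots A B sizes {d} {dg} ((f′ , d*f′≋f) , (h , d*h≋g) , greatest) d-deg =
    ℕₚ.≤-antisym dg≤#A #A≤dg
    where
    -- each common root β t gives a common factor X − β t of f and g, hence of d
    d-root : ∀ u → eval d (β (embed A u)) ≈ 0#
    d-root u = begin
      eval d x                              ≈⟨ eval-cong {linear x *ₚ quot} {d} x quot≋ ⟨
      eval (linear x *ₚ quot) x             ≈⟨ eval-*ₚ (linear x) quot x ⟩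
      eval (linear x) x * eval quot x       ≈⟨ *-congʳ (trans (eval-linear x x) (-‿inverseʳ x)) ⟩
      0# * eval quot x                      ≈⟨ zeroˡ _ ⟩
      0#                                    ∎
      where
      x = β (embed A u)
      linear∣d = greatest (linear x) (factor-theorem x f (embed-∈ A u)) (factor-theorem x g (g-roots (embed A u)))
      quot = proj₁ linear∣d
      quot≋ = proj₂ linear∣d

    #A≤dg : size A ℕ.≤ dg
    #A≤dg = roots≤degree d d-deg (β ∘ embed A) (embed-injective A ∘ β-inj) d-root

    h-deg : ∃ (Degree R h)
    h-deg = ¬IsZero⇒Degree h λ h≈0 →
      Degree⇒¬IsZero {g} g-deg (λ n → trans (sym (d*h≋g n)) (IsZero-*ₚʳ d h h≈0 n))

    dg+dh≡K : dg ℕ.+ proj₁ h-deg ≡ K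
    dg+dh≡K = Degree-unique {g} (Degree-cong {d *ₚ h} {g} d*h≋g (Degree-*ₚ d h d-deg (proj₂ h-deg))) g-deg

    -- the other roots of g are not roots of d, since d divides f
    h-root : ∀ u → eval h (β (embed B u)) ≈ 0#
    h-root u = *-cancelˡ-≈0 d≉0 (begin
      eval d x * eval h x ≈⟨ eval-*ₚ d h x ⟨
      eval (d *ₚ h) x     ≈⟨ eval-cong {d *ₚ h} {g} x d*h≋g ⟩
      eval g x            ≈⟨ g-roots (embed B u) ⟩
      0#                  ∎)
      where
      x = β (embed B u)
      d≉0 : ¬ (eval d x ≈ 0#)
      d≉0 d≈0 = embed-∈ B u (begin
        eval f x            ≈⟨ eval-cong {d *ₚ f′} {f} x d*f′≋f ⟨
        eval (d *ₚ f′) x    ≈⟨ eval-*ₚ d f′ x ⟩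
        eval d x * eval f′ x ≈⟨ *-congʳ d≈0 ⟩
        0# * eval f′ x      ≈⟨ zeroˡ _ ⟩
        0#                  ∎)

    #B≤dh : size B ℕ.≤ proj₁ h-deg
    #B≤dh = roots≤degree h (proj₂ h-deg) (β ∘ embed B) (embed-injective B ∘ β-inj) h-root

    dg≤#A : dg ℕ.≤ size A
    dg≤#A = ℕₚ.+-cancelʳ-≤ (size B) dg (size A)
      (ℕₚ.≤-trans (ℕₚ.+-monoʳ-≤ dg #B≤dh) (ℕₚ.≤-reflexive (≡.trans dg+dh≡K (≡.sym sizes))))


module BinomialMatrix {c ℓ} (R : CommutativeRing c ℓ) where

  open CommutativeRing R renaming (Carrier to F) hiding (zero)
  open import Relation.Binary.Reasoning.Setoid setoid
  open import Algebra.Properties.CommutativeSemigroup +-commutativeSemigroup using (xy∙z≈xz∙y)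
  open import Algebra.Properties.CommutativeSemigroup *-commutativeSemigroup using (x∙yz≈y∙xz)
  open RingProperties R

  private
    module Rows (α β : F) (k a b : ℕ) (βᵏ : pow R β (suc k) ≈ pow R α (a ℕ.* suc k)) where

      K = suc k
      A = pow R α (a ℕ.* K)
      B = pow R α (b ℕ.* K)

      -- Cmat R α K a b i j unfolds to entry (toℕ i) (toℕ j)
      entry : ℕ → ℕ → F
      entry i j = if i ℕ.<ᵇ j then fromℕ R (K C (j ∸ i))
                  else if j ℕ.<ᵇ i then A * fromℕ R (K C (i ∸ j))
                  else (1# + A) - B

      entry-above : ∀ {i j} → i ℕ.< j → entry i j ≡ fromℕ R (K C (j ∸ i))
      entry-above {zero} {suc j} _ = ≡.refl
      entry-above {suc i} {suc j} (ℕ.s≤s i<j) = entry-above i<j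

      rowSum : ℕ → F
      rowSum i = ∑ℕ K (λ j → entry i j * pow R β j)

      S : F
      S = ∑ℕ k (λ j → fromℕ R (K C suc j) * pow R β (suc j))

      expansion : pow R (β + 1#) K ≈ 1# + (S + A)
      expansion = begin
        pow R (β + 1#) K ≈⟨ binomial β K ⟩
        fromℕ R (K C 0) * 1# + ∑ℕ K (λ j → fromℕ R (K C suc j) * pow R β (suc j))
          ≈⟨ +-cong (trans (*-identityʳ _) (+-identityʳ _)) (∑ℕ-last k (λ j → fromℕ R (K C suc j) * pow R β (suc j))) ⟩
        1# + (S + fromℕ R (K C K) * pow R β K)
          ≈⟨ +-congˡ (+-congˡ (trans (*-cong (reflexive (≡.cong (fromℕ R) (nCn≡1 K))) βᵏ)
                                     (trans (*-congʳ (+-identityʳ 1#)) (*-identityˡ A)))) ⟩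
        1# + (S + A) ∎

      -- entry (suc i) (suc j) reduces to entry i j: row i + 1 is row i shifted right, with first entry
      -- A · C(K, i + 1) standing in for the last entry C(K, i + 1) of row i times β^K = A
      eigen : ∀ i → i ℕ.< K → rowSum i ≈ pow R β i * (pow R (β + 1#) K - B)
      eigen zero _ = begin
        ((1# + A) - B) * 1# + S ≈⟨ +-congʳ (*-identityʳ _) ⟩
        ((1# + A) - B) + S      ≈⟨ xy∙z≈xz∙y (1# + A) (- B) S ⟩
        ((1# + A) + S) - B      ≈⟨ +-congʳ (trans (+-assoc 1# A S) (+-congˡ (+-comm A S))) ⟩
        (1# + (S + A)) - B      ≈⟨ +-congʳ expansion ⟨
        pow R (β + 1#) K - B    ≈⟨ *-identityˡ _ ⟨
        1# * (pow R (β + 1#) K - B) ∎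
      eigen (suc i) (ℕ.s≤s i<k) = begin
        A * fromℕ R (K C suc i) * 1# + S′     ≈⟨ +-congʳ (trans (*-identityʳ _) (*-comm _ _)) ⟩
        fromℕ R (K C suc i) * A + S′          ≈⟨ +-comm _ _ ⟩
        S′ + fromℕ R (K C suc i) * A          ≈⟨ +-congˡ (*-cong (reflexive last-entry) (sym βᵏ)) ⟩
        S′ + entry i k * pow R β K            ≈⟨ ∑ℕ-last k (λ j → entry i j * pow R β (suc j)) ⟨
        ∑ℕ K (λ j → entry i j * pow R β (suc j))
          ≈⟨ ∑-cong {K} (λ j → x∙yz≈y∙xz (entry i (toℕ j)) β (pow R β (toℕ j))) ⟩
        ∑ℕ K (λ j → β * (entry i j * pow R β j)) ≈⟨ *-distribˡ-∑ {K} β (λ j → entry i (toℕ j) * pow R β (toℕ j)) ⟨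
        β * rowSum i                          ≈⟨ *-congˡ (eigen i (ℕₚ.m<n⇒m<1+n i<k)) ⟩
        β * (pow R β i * (pow R (β + 1#) K - B)) ≈⟨ *-assoc _ _ _ ⟨
        pow R β (suc i) * (pow R (β + 1#) K - B) ∎
        where
        S′ = ∑ℕ k (λ j → entry i j * pow R β (suc j))
        last-entry : fromℕ R (K C suc i) ≡ entry i k
        last-entry = ≡.trans (≡.cong (fromℕ R) C-symm) (≡.sym (entry-above i<k))
          where
          C-symm : K C suc i ≡ K C (k ∸ i)
          C-symm = ≡.sym (≡.trans (nCk≡nC[n∸k] (ℕₚ.≤-trans (ℕₚ.m∸n≤m k i) (ℕₚ.n≤1+n k)))
                                  (≡.cong (K C_) (≡.trans (ℕₚ.+-∸-assoc 1 (ℕₚ.m∸n≤m k i))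
                                                          (≡.cong suc (ℕₚ.m∸[m∸n]≡n (ℕₚ.<⇒≤ i<k))))))

  Cmat-eigenvector : ∀ (α β : F) k a b → pow R β k ≈ pow R α (a ℕ.* k) → ∀ i →
    ∑ R (λ j → Cmat R α k a b i j * pow R β (toℕ j)) ≈ pow R β (toℕ i) * (pow R (β + 1#) k - pow R α (b ℕ.* k))
  Cmat-eigenvector α β (suc k) a b βᵏ i = Rows.eigen α β k a b βᵏ (toℕ i) (Finₚ.toℕ<n i)


module PrimitiveElement {c ℓ} (R : CommutativeRing c ℓ) (fld : IsField R) {n : ℕ} (card : HasCard R (suc n))
                        (α : CommutativeRing.Carrier R) (prim : IsPrimitive R α) where

  open CommutativeRing R renaming (Carrier to F) hiding (zero)
  open import Relation.Binary.Reasoning.Setoid setoid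
  open RingProperties R
  open FieldProperties R fld

  private
    enum = proj₁ card
    enum-inj = proj₁ (proj₂ card)
    enum-surj = proj₂ (proj₂ card)

    index : F → Fin (suc n)
    index x = proj₁ (enum-surj x)

  nonzero : Fin n → F
  nonzero u = enum (punchIn (index 0#) u)

  nonzero≉0 : ∀ u → ¬ (nonzero u ≈ 0#)
  nonzero≉0 u u≈0 = Finₚ.punchInᵢ≢i (index 0#) u (enum-inj _ _ (trans u≈0 (sym (proj₂ (enum-surj 0#)))))

  nonzero-injective : Injective _≡_ _≈_ nonzero
  nonzero-injective = Finₚ.punchIn-injective (index 0#) _ _ ∘ enum-inj _ _

  nonzero-surjective : ∀ {x} → ¬ (x ≈ 0#) → Σ (Fin n) λ u → nonzero u ≈ x
  nonzero-surjective {x} x≉0 = punchOut index≢ , (begin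
    enum (punchIn (index 0#) (punchOut index≢)) ≡⟨ ≡.cong enum (Finₚ.punchIn-punchOut index≢) ⟩
    enum (index x)                              ≈⟨ proj₂ (enum-surj x) ⟩
    x                                           ∎)
    where
    index≢ : index 0# ≢ index x
    index≢ i≡ = x≉0 (begin
      x              ≈⟨ proj₂ (enum-surj x) ⟨
      enum (index x)  ≡⟨ ≡.cong enum i≡ ⟨
      enum (index 0#) ≈⟨ proj₂ (enum-surj 0#) ⟩
      0#             ∎)

  pow-α≉0 : ∀ m → ¬ (pow R α m ≈ 0#)
  pow-α≉0 m = pow-≉0 m (proj₁ prim)

  pow-mod : ∀ {x} d .{{_ : NonZero d}} → pow R x d ≈ 1# → ∀ m → pow R x m ≈ pow R x (m % d)
  pow-mod {x} d xᵈ≈1 m = begin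
    pow R x m                                 ≡⟨ ≡.cong (pow R x) (m≡m%n+[m/n]*n m d) ⟩
    pow R x (m % d ℕ.+ (m / d) ℕ.* d)         ≈⟨ pow-+ x (m % d) _ ⟩
    pow R x (m % d) * pow R x ((m / d) ℕ.* d) ≡⟨ ≡.cong (λ e → pow R x (m % d) * pow R x e) (ℕₚ.*-comm (m / d) d) ⟩
    pow R x (m % d) * pow R x (d ℕ.* (m / d)) ≈⟨ *-congˡ (trans (pow-* x d (m / d)) (trans (pow-cong (m / d) xᵈ≈1) (pow-1# (m / d)))) ⟩
    pow R x (m % d) * 1#                      ≈⟨ *-identityʳ _ ⟩
    pow R x (m % d)                           ∎

  pow-∸≈1 : ∀ {i j} → i ℕ.≤ j → pow R α i ≈ pow R α j → pow R α (j ∸ i) ≈ 1#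
  pow-∸≈1 {i} {j} i≤j αⁱ≈αʲ = *-cancelˡ (pow-α≉0 i) (begin
    pow R α i * pow R α (j ∸ i) ≈⟨ pow-+ α i (j ∸ i) ⟨
    pow R α (i ℕ.+ (j ∸ i))     ≡⟨ ≡.cong (pow R α) (ℕₚ.m+[n∸m]≡n i≤j) ⟩
    pow R α j                   ≈⟨ αⁱ≈αʲ ⟨
    pow R α i                   ≈⟨ *-identityʳ _ ⟨
    pow R α i * 1#              ∎)

  -- pigeonhole: α⁰, …, αⁿ are n + 1 values among the n nonzero elements
  ∃pow≈1 : Σ ℕ λ d → 0 ℕ.< d × d ℕ.≤ n × pow R α d ≈ 1#
  ∃pow≈1 with Finₚ.pigeonhole (ℕₚ.n<1+n n) (λ i → proj₁ (nonzero-surjective (pow-α≉0 (toℕ i))))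
  ... | i , j , i<j , same = toℕ j ∸ toℕ i , ℕₚ.m<n⇒0<n∸m i<j ,
        ℕₚ.≤-trans (ℕₚ.m∸n≤m (toℕ j) (toℕ i)) (ℕₚ.≤-pred (Finₚ.toℕ<n j)) ,
        pow-∸≈1 (ℕₚ.<⇒≤ i<j) (begin
          pow R α (toℕ i)                                     ≈⟨ proj₂ (nonzero-surjective (pow-α≉0 (toℕ i))) ⟨
          nonzero (proj₁ (nonzero-surjective (pow-α≉0 (toℕ i)))) ≡⟨ ≡.cong nonzero same ⟩
          nonzero (proj₁ (nonzero-surjective (pow-α≉0 (toℕ j)))) ≈⟨ proj₂ (nonzero-surjective (pow-α≉0 (toℕ j))) ⟩
          pow R α (toℕ j)                                     ∎)

  -- if αᵈ ≈ 1 then the n nonzero elements are among α⁰, …, αᵈ⁻¹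
  pow≉1 : ∀ d → 0 ℕ.< d → d ℕ.< n → ¬ (pow R α d ≈ 1#)
  pow≉1 d@(suc _) _ d<n αᵈ≈1 = ℕₚ.<⇒≱ d<n (Finₚ.injective⇒≤ exponent-injective)
    where
    exponent : Fin n → ℕ
    exponent u = proj₁ (proj₂ prim (nonzero u) (nonzero≉0 u))
    α^exponent : ∀ u → pow R α (exponent u) ≈ nonzero u
    α^exponent u = proj₂ (proj₂ prim (nonzero u) (nonzero≉0 u))
    exponent-mod : Fin n → Fin d
    exponent-mod u = Fin.fromℕ< (m%n<n (exponent u) d)
    exponent-injective : Injective _≡_ _≡_ exponent-mod
    exponent-injective {u} {v} same = nonzero-injective (begin
      nonzero u                  ≈⟨ α^exponent u ⟨
      pow R α (exponent u)       ≈⟨ pow-mod d αᵈ≈1 (exponent u) ⟩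
      pow R α (exponent u % d)   ≡⟨ ≡.cong (pow R α) mod≡ ⟩
      pow R α (exponent v % d)   ≈⟨ pow-mod d αᵈ≈1 (exponent v) ⟨
      pow R α (exponent v)       ≈⟨ α^exponent v ⟩
      nonzero v                  ∎)
      where
      mod≡ : exponent u % d ≡ exponent v % d
      mod≡ = ≡.trans (≡.sym (Finₚ.toℕ-fromℕ< (m%n<n (exponent u) d)))
               (≡.trans (≡.cong toℕ same) (Finₚ.toℕ-fromℕ< (m%n<n (exponent v) d)))

  <⇒pow≉ : ∀ {i j} → i ℕ.< j → j ℕ.< n → ¬ (pow R α i ≈ pow R α j)
  <⇒pow≉ {i} {j} i<j j<n αⁱ≈αʲ =
    pow≉1 (j ∸ i) (ℕₚ.m<n⇒0<n∸m i<j) (ℕₚ.≤-<-trans (ℕₚ.m∸n≤m j i) j<n) (pow-∸≈1 (ℕₚ.<⇒≤ i<j) αⁱ≈αʲ)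

  pow-injective : ∀ {i j} → i ℕ.< n → j ℕ.< n → pow R α i ≈ pow R α j → i ≡ j
  pow-injective {i} {j} i<n j<n αⁱ≈αʲ with ℕₚ.<-cmp i j
  ... | tri≈ _ i≡j _ = i≡j
  ... | tri< i<j _ _ = ⊥-elim (<⇒pow≉ i<j j<n αⁱ≈αʲ)
  ... | tri> _ _ j<i = ⊥-elim (<⇒pow≉ j<i i<n (sym αⁱ≈αʲ))

  pow-n≈1 : pow R α n ≈ 1#
  pow-n≈1 with ∃pow≈1
  ... | d , 0<d , d≤n , αᵈ≈1 with ℕₚ.m≤n⇒m<n∨m≡n d≤n
  ...   | inj₁ d<n = ⊥-elim (pow≉1 d 0<d d<n αᵈ≈1)
  ...   | inj₂ d≡n = ≡.subst (λ m → pow R α m ≈ 1#) d≡n αᵈ≈1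

  pow-≈⇒%-≡ : ∀ .{{_ : NonZero n}} {i j} → pow R α i ≈ pow R α j → i % n ≡ j % n
  pow-≈⇒%-≡ {i} {j} αⁱ≈αʲ = pow-injective (m%n<n i n) (m%n<n j n)
    (trans (sym (pow-mod n pow-n≈1 i)) (trans αⁱ≈αʲ (pow-mod n pow-n≈1 j)))


module CyclotomicClasses {c ℓ} (R : CommutativeRing c ℓ) (fld : IsField R) (e′ k′ : ℕ)
                         (card : HasCard R (suc (suc e′ ℕ.* suc k′)))
                         (α : CommutativeRing.Carrier R) (prim : IsPrimitive R α) where

  open CommutativeRing R renaming (Carrier to F) hiding (zero)
  open import Relation.Binary.Reasoning.Setoid setoid
  open RingProperties R
  open FieldProperties R fld

  e = suc e′
  K = suc k′

  open PrimitiveElement R fld card α prim public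

  pow-class : ∀ s r → pow R (pow R α (e ℕ.* s ℕ.+ r)) K ≈ pow R α (r ℕ.* K)
  pow-class s r = begin
    pow R (pow R α (e ℕ.* s ℕ.+ r)) K        ≈⟨ pow-* α (e ℕ.* s ℕ.+ r) K ⟨
    pow R α ((e ℕ.* s ℕ.+ r) ℕ.* K)          ≡⟨ ≡.cong (pow R α) (distribute e s r K) ⟩
    pow R α (e ℕ.* K ℕ.* s ℕ.+ r ℕ.* K)      ≈⟨ pow-+ α (e ℕ.* K ℕ.* s) (r ℕ.* K) ⟩
    pow R α (e ℕ.* K ℕ.* s) * pow R α (r ℕ.* K)
      ≈⟨ *-congʳ (trans (pow-* α (e ℕ.* K) s) (trans (pow-cong s pow-n≈1) (pow-1# s))) ⟩
    1# * pow R α (r ℕ.* K)                   ≈⟨ *-identityˡ _ ⟩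
    pow R α (r ℕ.* K)                        ∎
    where
    distribute : ∀ e s r K → (e ℕ.* s ℕ.+ r) ℕ.* K ≡ e ℕ.* K ℕ.* s ℕ.+ r ℕ.* K
    distribute = solve-∀

  module Class {a : ℕ} (a<e : a ℕ.< e) where

    -- the elements of C_a, i.e. the K roots of X^K − α^(aK)
    β : Fin K → F
    β t = pow R α (e ℕ.* toℕ t ℕ.+ a)

    β-pow : ∀ t → pow R (β t) K ≈ pow R α (a ℕ.* K)
    β-pow t = pow-class (toℕ t) a

    β-injective : Injective _≡_ _≈_ β
    β-injective {t} {t′} βt≈βt′ = Finₚ.toℕ-injective (ℕₚ.*-cancelˡ-≡ (toℕ t) (toℕ t′) e
      (ℕₚ.+-cancelʳ-≡ a _ _ (pow-injective (exponent<n t) (exponent<n t′) βt≈βt′)))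
      where
      exponent<n : ∀ t → e ℕ.* toℕ t ℕ.+ a ℕ.< e ℕ.* K
      exponent<n t = ℕₚ.<-≤-trans (ℕₚ.+-monoʳ-< (e ℕ.* toℕ t) a<e)
        (ℕₚ.≤-trans (ℕₚ.≤-reflexive (*-suc e (toℕ t))) (ℕₚ.*-monoʳ-≤ e (Finₚ.toℕ<n t)))
        where
        *-suc : ∀ e t → e ℕ.* t ℕ.+ e ≡ e ℕ.* suc t
        *-suc = solve-∀

    InClass⇒≈β : ∀ {y} → InClass R α e a y → ∃ λ t → y ≈ β t
    InClass⇒≈β {y} (s , y≈) = Fin.fromℕ< (m%n<n s K) , (begin
      y                                          ≈⟨ y≈ ⟩
      pow R α (e ℕ.* s ℕ.+ a)                    ≡⟨ ≡.cong (pow R α) split ⟩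
      pow R α ((e ℕ.* (s % K) ℕ.+ a) ℕ.+ e ℕ.* K ℕ.* (s / K))
        ≈⟨ pow-+ α (e ℕ.* (s % K) ℕ.+ a) (e ℕ.* K ℕ.* (s / K)) ⟩
      pow R α (e ℕ.* (s % K) ℕ.+ a) * pow R α (e ℕ.* K ℕ.* (s / K))
        ≈⟨ *-congˡ (trans (pow-* α (e ℕ.* K) (s / K)) (trans (pow-cong (s / K) pow-n≈1) (pow-1# (s / K)))) ⟩
      pow R α (e ℕ.* (s % K) ℕ.+ a) * 1#         ≈⟨ *-identityʳ _ ⟩
      pow R α (e ℕ.* (s % K) ℕ.+ a)              ≡⟨ ≡.cong (λ r → pow R α (e ℕ.* r ℕ.+ a)) (Finₚ.toℕ-fromℕ< (m%n<n s K)) ⟨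
      β (Fin.fromℕ< (m%n<n s K))                 ∎)
      where
      rearrange : ∀ e r d K a → e ℕ.* (r ℕ.+ d ℕ.* K) ℕ.+ a ≡ (e ℕ.* r ℕ.+ a) ℕ.+ e ℕ.* K ℕ.* d
      rearrange = solve-∀
      split : e ℕ.* s ℕ.+ a ≡ (e ℕ.* (s % K) ℕ.+ a) ℕ.+ e ℕ.* K ℕ.* (s / K)
      split = ≡.trans (≡.cong (λ m → e ℕ.* m ℕ.+ a) (m≡m%n+[m/n]*n s K)) (rearrange e (s % K) (s / K) K a)

  InClass⇒pow≈ : ∀ {r x} → InClass R α e r x → pow R x K ≈ pow R α (r ℕ.* K)
  InClass⇒pow≈ {r} (s , x≈) = trans (pow-cong K x≈) (pow-class s r)

  module _ {b : ℕ} (b<e : b ℕ.< e) where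

    -- x^K determines the exponent of x modulo e, since α has order eK
    pow≈⇒InClass : ∀ {x} → pow R x K ≈ pow R α (b ℕ.* K) → InClass R α e b x
    pow≈⇒InClass {x} xᴷ≈ = m / e , trans (sym αᵐ≈x) (reflexive (≡.cong (pow R α) m≡))
      where
      x≉0 : ¬ (x ≈ 0#)
      x≉0 x≈0 = pow-α≉0 (b ℕ.* K) (trans (sym xᴷ≈) (trans (pow-cong K x≈0) (zeroˡ _)))
      m = proj₁ (proj₂ prim x x≉0)
      αᵐ≈x : pow R α m ≈ x
      αᵐ≈x = proj₂ (proj₂ prim x x≉0)
      mK≡bK : (m ℕ.* K) % (e ℕ.* K) ≡ (b ℕ.* K) % (e ℕ.* K)
      mK≡bK = pow-≈⇒%-≡ {m ℕ.* K} {b ℕ.* K} (trans (pow-* α m K) (trans (pow-cong K αᵐ≈x) xᴷ≈))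
      m%e≡b : m % e ≡ b
      m%e≡b = ≡.trans (ℕₚ.*-cancelʳ-≡ (m % e) (b % e) K
                         (≡.trans (m%n*o≡m*o%[n*o] m e K) (≡.trans mK≡bK (≡.sym (m%n*o≡m*o%[n*o] b e K)))))
                      (m<n⇒m%n≡m b<e)
      reorder : ∀ r d e → r ℕ.+ d ℕ.* e ≡ e ℕ.* d ℕ.+ r
      reorder = solve-∀
      m≡ : m ≡ e ℕ.* (m / e) ℕ.+ b
      m≡ = ≡.trans (m≡m%n+[m/n]*n m e) (≡.trans (reorder (m % e) (m / e) e) (≡.cong (e ℕ.* (m / e) ℕ.+_) m%e≡b))


module CyclotomicNumbers {c ℓ} (R : CommutativeRing c ℓ) (fld : IsField R) (e′ k′ : ℕ)
                         (card : HasCard R (suc (suc e′ ℕ.* suc k′)))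
                         (α : CommutativeRing.Carrier R) (prim : IsPrimitive R α)
                         {a b : ℕ} (a<e : a ℕ.< suc e′) (b<e : b ℕ.< suc e′) where

  open CommutativeRing R renaming (Carrier to F) hiding (zero)
  open import Relation.Binary.Reasoning.Setoid setoid
  open import Algebra.Properties.Group +-group using (x∙y⁻¹≈ε⇒x≈y; x≈y⇒x∙y⁻¹≈ε)
  open RingProperties R
  open LinearAlgebra R fld card using (_≟_)
  open Polynomials R fld card
  open Enumerations R
  open CyclotomicClasses R fld e′ k′ card α prim
  open Class a<e

  f = polyF R α K b
  g = polyG R α K a

  eval-f : ∀ x → eval f x ≈ pow R (x + 1#) K - pow R α (b ℕ.* K)
  eval-f x = trans (eval-+ₚ-constₚ (powₚ (Xₚ +ₚ constₚ 1#) K) _ x)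
    (+-congʳ (trans (eval-powₚ (Xₚ +ₚ constₚ 1#) K x) (pow-cong K (trans (eval-+ₚ-constₚ Xₚ 1# x) (+-congʳ (eval-Xₚ x))))))

  eval-g : ∀ x → eval g x ≈ pow R x K - pow R α (a ℕ.* K)
  eval-g x = trans (eval-+ₚ-constₚ (powₚ Xₚ K) _ x) (+-congʳ (trans (eval-powₚ Xₚ K x) (pow-cong K (eval-Xₚ x))))

  Root : Fin K → Set ℓ
  Root t = eval f (β t) ≈ 0#

  private
    split = partition K (λ t → eval f (β t) ≟ 0#)

  roots : Enumeration K Root
  roots = proj₁ split

  nonroots : Enumeration K (¬_ ∘ Root)
  nonroots = proj₁ (proj₂ split)

  #roots+#nonroots : size roots ℕ.+ size nonroots ≡ K
  #roots+#nonroots = proj₂ (proj₂ split)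

  private
    x+1-1≈x : ∀ x → (x + 1#) - 1# ≈ x
    x+1-1≈x x = trans (+-assoc x 1# (- 1#)) (trans (+-congˡ (-‿inverseʳ 1#)) (+-identityʳ x))

  cyclotomic≡#roots : ∀ {N} → CyclotomicNumber R α e a b N → N ≡ size roots
  cyclotomic≡#roots {N} (x , x-inj , x∈ , x-surj) =
    ℕₚ.≤-antisym (Finₚ.injective⇒≤ {f = φ} φ-inj) (Finₚ.injective⇒≤ {f = ψ} ψ-inj)
    where
    shifted : ∀ i → ∃ λ t → x i - 1# ≈ β t
    shifted i = InClass⇒≈β (proj₂ (x∈ i))

    root : ∀ i → Root (proj₁ (shifted i))
    root i = trans (eval-f (β t)) (x≈y⇒x∙y⁻¹≈ε (begin
      pow R (β t + 1#) K       ≈⟨ pow-cong K (+-congʳ (proj₂ (shifted i))) ⟨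
      pow R (x i - 1# + 1#) K  ≈⟨ pow-cong K (x-y+y≈x (x i) 1#) ⟩
      pow R (x i) K            ≈⟨ InClass⇒pow≈ (proj₁ (x∈ i)) ⟩
      pow R α (b ℕ.* K)        ∎))
      where t = proj₁ (shifted i)

    φ : Fin N → Fin (size roots)
    φ i = proj₁ (embed-surjective roots (proj₁ (shifted i)) (root i))

    φ-inj : Injective _≡_ _≡_ φ
    φ-inj {i} {j} φi≡φj = x-inj i j (begin
      x i          ≈⟨ x-y+y≈x (x i) 1# ⟨
      x i - 1# + 1# ≈⟨ +-congʳ (trans (proj₂ (shifted i)) (reflexive (≡.cong β same-t))) ⟩
      β tj + 1#    ≈⟨ +-congʳ (proj₂ (shifted j)) ⟨
      x j - 1# + 1# ≈⟨ x-y+y≈x (x j) 1# ⟩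
      x j          ∎)
      where
      tj = proj₁ (shifted j)
      same-t : proj₁ (shifted i) ≡ tj
      same-t = ≡.trans (≡.sym (proj₂ (embed-surjective roots (proj₁ (shifted i)) (root i))))
                       (≡.trans (≡.cong (embed roots) φi≡φj) (proj₂ (embed-surjective roots tj (root j))))

    member : ∀ u → CycSet R α e a b (β (embed roots u) + 1#)
    member u =
      pow≈⇒InClass b<e (x∙y⁻¹≈ε⇒x≈y (pow R (βᵤ + 1#) K) (pow R α (b ℕ.* K)) (trans (sym (eval-f βᵤ)) (embed-∈ roots u))) ,
      (toℕ (embed roots u) , x+1-1≈x βᵤ)
      where βᵤ = β (embed roots u)

    preimage : ∀ u → ∃ λ i → x i ≈ β (embed roots u) + 1#
    preimage u = x-surj (β (embed roots u) + 1#) (member u)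

    ψ : Fin (size roots) → Fin N
    ψ u = proj₁ (preimage u)

    ψ-inj : Injective _≡_ _≡_ ψ
    ψ-inj {u} {v} ψu≡ψv = embed-injective roots (β-injective (begin
      β (embed roots u)            ≈⟨ x+1-1≈x (β (embed roots u)) ⟨
      β (embed roots u) + 1# - 1#
        ≈⟨ +-congʳ (trans (sym (proj₂ (preimage u))) (trans (reflexive (≡.cong x ψu≡ψv)) (proj₂ (preimage v)))) ⟩
      β (embed roots v) + 1# - 1#  ≈⟨ x+1-1≈x (β (embed roots v)) ⟩
      β (embed roots v)            ∎))

  gcd-degree≡#roots : ∀ {d dg} → IsGCD R d f g → Degree R d dg → dg ≡ size roots
  gcd-degree≡#roots {d} {dg} = GcdDegree.gcd-degree R fld card f g (Degree-Xₚ^-+ₚ-constₚ k′ (- pow R α (a ℕ.* K))) β β-injective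
    (λ t → trans (eval-g (β t)) (x≈y⇒x∙y⁻¹≈ε (β-pow t))) roots nonroots #roots+#nonroots {d} {dg}

  rank≡#nonroots : ∀ {r} → Rank R (Cmat R α K a b) r → r ≡ size nonroots
  rank≡#nonroots {r} = Diagonalisable.rank≡#nonzero R fld card (Cmat R α K a b) (λ t j → pow R (β t) (toℕ j))
    (λ t → eval f (β t)) (powers-LinIndep β β-injective)
    (λ t i → trans (BinomialMatrix.Cmat-eigenvector R α (β t) K a b (β-pow t) i) (*-congˡ (sym (eval-f (β t)))))
    nonroots {r}


open import Data.Nat using (_*_; _<_)

lemma3p1 : ∀ {c ℓ : Level} (R : CommutativeRing c ℓ) → IsField R →
    (q : ℕ) → IsPrimePower q → HasCard R q →
    (k e : ℕ) → 0 < k → e * k ≡ q ∸ 1 →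
    (α : CommutativeRing.Carrier R) → IsPrimitive R α →
    (a b : ℕ) → a < e → b < e →
    (N r dg : ℕ) (d : Poly R) →
    CyclotomicNumber R α e a b N →
    Rank R (Cmat R α k a b) r →
    IsGCD R d (polyF R α k b) (polyG R α k a) → Degree R d dg →
    (N ≡ k ∸ r) × (N ≡ dg)
lemma3p1 R fld zero _ _ (suc k′) (suc e′) _ () α prim a b a<e b<e N r dg d cyc rank gcd deg
lemma3p1 R fld (suc q′) _ card (suc k′) (suc e′) _ ek≡q′ α prim a b a<e b<e N r dg d cyc rank gcd deg =
  ≡.trans N≡#roots (≡.sym k∸r≡#roots) , ≡.trans N≡#roots (≡.sym (gcd-degree≡#roots {d} {dg} gcd deg))
  where
  card′ : HasCard R (suc (suc e′ * suc k′))
  card′ = ≡.subst (λ m → HasCard R (suc m)) (≡.sym ek≡q′) card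
  open CyclotomicNumbers R fld e′ k′ card′ α prim a<e b<e
  open Enumerations R using (size)
  N≡#roots : N ≡ size roots
  N≡#roots = cyclotomic≡#roots cyc
  k∸r≡#roots : suc k′ ∸ r ≡ size roots
  k∸r≡#roots = begin
    suc k′ ∸ r                                ≡⟨ ≡.cong₂ _∸_ (≡.sym #roots+#nonroots) (rank≡#nonroots {r} rank) ⟩
    (size roots ℕ.+ size nonroots) ∸ size nonroots ≡⟨ ℕₚ.m+n∸n≡m (size roots) (size nonroots) ⟩
    size roots                                ∎
    where open ≡.≡-Reasoning
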